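{- Let $a$ and $b$ be coprime natural numbers, and let $t$ be a natural number such that $a^2+1\equiv 0 \pmod t$ and $\gcd(b,t)=1$. Let $a^*$ be an integer with $aa^*\equiv 1 \pmod b$ and $b^*$ an integer with $bb^*\equiv 1\pmod a$. Then \[ S(ta^*,b)+S(tb^*,a)=\frac{a^2+b^2+t^2}{tab}-3+S(ab,t). \]
   Context: For $x\in\mathbb{R}$ let $((x))=x-\lfloor x\rfloor-1/2$ if $x\notin\mathbb{Z}$ and $((x))=0$ if $x\in\mathbb{Z}$. For an integer $a$ and a natural number $b$ with $\gcd(a,b)=1$, the classical Dedekind sum is $s(a,b)=\sum_{k=1}^{b}((k/b))((ak/b))$, and the normalized Dedekind sum is $S(a,b)=12\,s(a,b)$. (Note $S(a,b)$ depends only on $a$ modulo $b$, so the choice of the inverses $a^*,b^*$ does not matter.) -}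

module Defs where

open import Data.Nat as ℕ using (ℕ; zero; suc; NonZero; _≡ᵇ_)
open import Data.Integer as ℤ using (ℤ; +_)
open import Data.Rational using (ℚ; _/_; _+_; _-_; _*_; 0ℚ; ½; floor; ↧ₙ_)
open import Data.Bool using (if_then_else_)

-- The sawtooth function ((x)) on rationals:
-- ((x)) = x - ⌊x⌋ - 1/2 if x is not an integer, and 0 if x is an integer.
-- (A rational in normal form is an integer iff its denominator is 1.)
saw : ℚ → ℚ
saw x = if (↧ₙ x) ≡ᵇ 1 then 0ℚ else ((x - (floor x / 1)) - ½)

sum1 : ℕ → (ℕ → ℚ) → ℚ
sum1 zero    f = 0ℚ
sum1 (suc n) f = sum1 n f + f (suc n)

dedekind : ℤ → (b : ℕ) → .{{NonZero b}} → ℚ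
dedekind a b = sum1 b (λ k → saw (+ k / b) * saw ((a ℤ.* + k) / b))

S : ℤ → (b : ℕ) → .{{NonZero b}} → ℚ
S a b = (+ 12 / 1) * dedekind a b

module Submission where

-- Write P d r = 2r - d, so that 2d((n/d)) = P d (n mod d) whenever d does not divide n.
-- For all integers i, j, k the number
--   E = c P(ab, ib + ja) + a P(bc, kb - jc) - b P(ac, ic + ka)
-- equals abc or -abc: the relation c(ib + ja) + a(kb - jc) = b(ic + ka) makes the residue part
-- c r₁ + a r₂ - b r₃ of E a multiple of abc, and its size confines it to {0, abc}.
-- Summing E² = (abc)² over 0 ≤ i < a, 0 ≤ j < b, 0 ≤ k < c, the squared terms are sums over complete
-- residue systems, and each cross term collapses, after summing out one variable, to a sum
-- D = Σⱼ P(d, jx) P(d, jy) for one modulus d; this gives Rademacher's three-term relation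
--   3a²c²D₁ - 3b²c²D₂ - 3a²b²D₃ = -abc(a² + b² + c²).
-- The substitution j ↦ x⁻¹j turns each D into d² ± 4d² s(h, d). For c = t dividing a² + 1 the
-- inverse of a modulo t is -a, which produces S(ta*, b), S(tb*, a) and S(ab, t).

module Reciprocity where

  open import Data.Nat as ℕ using (ℕ; zero; suc; NonZero)
  import Data.Nat.Properties as ℕP
  open import Data.Integer
    using (ℤ; +_; -[1+_]; +[1+_]; _+_; _*_; -_; _-_; _⊖_; _%ℕ_; _/ℕ_; 0ℤ; 1ℤ)
  open import Data.Integer.Properties
  open import Data.Integer.DivMod using (a≡a%ℕn+[a/ℕn]*n; n%ℕd<d)
  open import Data.Integer.Tactic.RingSolver
  import Data.Nat.Divisibility as ℕ∣
  import Data.Integer.Divisibility as ℤ∣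
  open import Data.Integer.Divisibility.Signed using (divides; ∣ᵤ⇒∣)
  open import Data.Nat.Coprimality using (coprime-Bézout; gcd≡1⇒coprime)
  open import Data.Nat.GCD using (gcd; gcd-comm; module Bézout)
  open import Data.List using (_∷_; [])
  open import Data.Product using (∃-syntax; _,_; proj₁; proj₂; _×_)
  open import Data.Sum using (_⊎_; inj₁; inj₂)
  open import Data.Empty using (⊥-elim)
  open import Relation.Nullary using (yes; no)
  open import Relation.Binary.PropositionalEquality
  open import Algebra.Properties.CommutativeSemigroup +-commutativeSemigroup
    using () renaming (interchange to +-interchange)
  open import Algebra.Properties.CommutativeSemigroup *-commutativeSemigroup
    using () renaming (xy∙z≈xz∙y to *-right-comm)
  open import Algebra.Properties.AbelianGroup +-0-abelianGroup
    using () renaming (∙-cancelʳ to +-cancelʳ)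
  open ≡-Reasoning

  -- Finite sums

  Σ< : ℕ → (ℕ → ℤ) → ℤ
  Σ< zero    f = 0ℤ
  Σ< (suc n) f = Σ< n f + f n

  syntax Σ< n (λ k → e) = Σ[ k < n ] e

  Σ<-cong : ∀ n {f g : ℕ → ℤ} → (∀ k → k ℕ.< n → f k ≡ g k) → Σ< n f ≡ Σ< n g
  Σ<-cong zero    f≗g = refl
  Σ<-cong (suc n) f≗g =
    cong₂ _+_ (Σ<-cong n (λ k k<n → f≗g k (ℕP.m<n⇒m<1+n k<n))) (f≗g n (ℕP.n<1+n n))

  Σ<-+ : ∀ n (f g : ℕ → ℤ) → Σ[ k < n ] (f k + g k) ≡ Σ< n f + Σ< n g
  Σ<-+ zero    f g = refl
  Σ<-+ (suc n) f g rewrite Σ<-+ n f g = +-interchange (Σ< n f) (Σ< n g) (f n) (g n)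

  Σ<-*ˡ : ∀ n (c : ℤ) (f : ℕ → ℤ) → Σ[ k < n ] (c * f k) ≡ c * Σ< n f
  Σ<-*ˡ zero    c f = sym (*-zeroʳ c)
  Σ<-*ˡ (suc n) c f rewrite Σ<-*ˡ n c f = sym (*-distribˡ-+ c (Σ< n f) (f n))

  Σ<-*ʳ : ∀ n (c : ℤ) (f : ℕ → ℤ) → Σ[ k < n ] (f k * c) ≡ Σ< n f * c
  Σ<-*ʳ n c f = trans (Σ<-cong n (λ k _ → *-comm (f k) c)) (trans (Σ<-*ˡ n c f) (*-comm c _))

  Σ<-neg : ∀ n (f : ℕ → ℤ) → Σ[ k < n ] (- f k) ≡ - Σ< n f
  Σ<-neg zero    f = refl
  Σ<-neg (suc n) f rewrite Σ<-neg n f = sym (neg-distrib-+ (Σ< n f) (f n))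

  Σ<-const : ∀ n (c : ℤ) → Σ[ k < n ] c ≡ + n * c
  Σ<-const zero    c = sym (*-zeroˡ c)
  Σ<-const (suc n) c rewrite Σ<-const n c | pos-+ 1 n = step (+ n) c
    where
    step : ∀ k c → k * c + c ≡ (1ℤ + k) * c
    step = solve-∀

  Σ<-comm : ∀ m n (f : ℕ → ℕ → ℤ) →
            Σ[ i < m ] Σ[ j < n ] f i j ≡ Σ[ j < n ] Σ[ i < m ] f i j
  Σ<-comm zero    n f = sym (trans (Σ<-const n 0ℤ) (*-zeroʳ (+ n)))
  Σ<-comm (suc m) n f rewrite Σ<-comm m n f = sym (Σ<-+ n (λ j → Σ[ i < m ] f i j) (λ j → f m j))

  Σ<-scaled-* : ∀ n {f g F G : ℕ → ℤ} (u v : ℤ) → (∀ j → f j ≡ u * F j) → (∀ j → g j ≡ v * G j) →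
                Σ[ j < n ] (f j * g j) ≡ u * v * Σ[ j < n ] (F j * G j)
  Σ<-scaled-* n {f} {g} {F} {G} u v f≡ g≡ = trans (Σ<-cong n (λ j _ → trans (cong₂ _*_ (f≡ j) (g≡ j)) (regroup u v (F j) (G j))))
                                               (Σ<-*ˡ n (u * v) (λ j → F j * G j))
    where
    regroup : ∀ u v x y → (u * x) * (v * y) ≡ u * v * (x * y)
    regroup = solve-∀

  Σ<-shift : ∀ n (f : ℕ → ℤ) → Σ[ k < n ] f (suc k) + f 0 ≡ Σ< n f + f n
  Σ<-shift zero    f = refl
  Σ<-shift (suc n) f = begin
    Σ[ k < n ] f (suc k) + f (suc n) + f 0     ≡⟨ +-assoc (Σ[ k < n ] f (suc k)) _ _ ⟩
    Σ[ k < n ] f (suc k) + (f (suc n) + f 0)   ≡⟨ cong (_+_ (Σ[ k < n ] f (suc k))) (+-comm (f (suc n)) _) ⟩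
    Σ[ k < n ] f (suc k) + (f 0 + f (suc n))   ≡⟨ sym (+-assoc (Σ[ k < n ] f (suc k)) _ _) ⟩
    Σ[ k < n ] f (suc k) + f 0 + f (suc n)     ≡⟨ cong (_+ f (suc n)) (Σ<-shift n f) ⟩
    Σ< n f + f n + f (suc n)                   ∎

  Σ<-suc : ∀ n (f : ℕ → ℤ) → Σ< (suc n) f ≡ f 0 + Σ[ k < n ] f (suc k)
  Σ<-suc n f = trans (sym (Σ<-shift n f)) (+-comm _ (f 0))

  Σ<-reverse : ∀ n (f : ℕ → ℤ) → Σ[ i < n ] f (n ℕ.∸ suc i) ≡ Σ< n f
  Σ<-reverse zero    f = refl
  Σ<-reverse (suc n) f = begin
    Σ[ i < suc n ] f (n ℕ.∸ i)             ≡⟨ Σ<-suc n (λ i → f (n ℕ.∸ i)) ⟩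
    f n + Σ[ i < n ] f (n ℕ.∸ suc i)       ≡⟨ cong (_+_ (f n)) (Σ<-reverse n f) ⟩
    f n + Σ< n f                           ≡⟨ +-comm (f n) _ ⟩
    Σ< n f + f n                           ∎

  Σ<-linear : ∀ n (u v : ℤ) →
              + 2 * Σ[ m < n ] (u + v * + m) ≡ + n * (+ 2 * u + v * (+ n - 1ℤ))
  Σ<-linear zero    u v = refl
  Σ<-linear (suc n) u v rewrite *-distribˡ-+ (+ 2) (Σ[ m < n ] (u + v * + m)) (u + v * + n)
                              | Σ<-linear n u v | pos-+ 1 n = step (+ n) u v
    where
    step : ∀ k u v → k * (+ 2 * u + v * (k - 1ℤ)) + + 2 * (u + v * k)
                       ≡ (1ℤ + k) * (+ 2 * u + v * (1ℤ + k - 1ℤ))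
    step = solve-∀

  Σ<-square : ∀ n (u v : ℤ) →
              + 6 * Σ[ m < n ] ((u + v * + m) * (u + v * + m))
                ≡ + n * (+ 6 * u * u + + 6 * u * v * (+ n - 1ℤ) + v * v * (+ n - 1ℤ) * (+ 2 * + n - 1ℤ))
  Σ<-square zero    u v = refl
  Σ<-square (suc n) u v rewrite *-distribˡ-+ (+ 6) (Σ[ m < n ] ((u + v * + m) * (u + v * + m))) ((u + v * + n) * (u + v * + n))
                              | Σ<-square n u v | pos-+ 1 n = step (+ n) u v
    where
    step : ∀ k u v → k * (+ 6 * u * u + + 6 * u * v * (k - 1ℤ) + v * v * (k - 1ℤ) * (+ 2 * k - 1ℤ))
                       + + 6 * ((u + v * k) * (u + v * k))
                     ≡ (1ℤ + k) * (+ 6 * u * u + + 6 * u * v * (1ℤ + k - 1ℤ)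
                                   + v * v * (1ℤ + k - 1ℤ) * (+ 2 * (1ℤ + k) - 1ℤ))
    step = solve-∀

  -- Residues of integers

  residue-offset≡0 : ∀ (e : ℤ) (d r r′ : ℕ) → r ℕ.< d → r′ ℕ.< d → + r′ ≡ + r + e * + d → e ≡ 0ℤ
  residue-offset≡0 (+ zero)   d r r′ _   _    _  = refl
  residue-offset≡0 +[1+ k ]   d r r′ _   r′<d eq =
    ⊥-elim (ℕP.<⇒≱ r′<d (ℕP.≤-trans (ℕP.m≤n*m d (suc k)) (ℕP.≤-trans (ℕP.m≤n+m _ r) (ℕP.≤-reflexive (sym r′≡)))))
    where
    r′≡ : r′ ≡ r ℕ.+ suc k ℕ.* d
    r′≡ = +-injective (trans eq (trans (cong (_+_ (+ r)) (sym (pos-* (suc k) d))) (sym (pos-+ r _))))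
  residue-offset≡0 -[1+ k ]   d r r′ r<d _    eq =
    ⊥-elim (ℕP.<⇒≱ r<d (ℕP.≤-trans (ℕP.m≤n*m d (suc k)) (ℕP.≤-trans (ℕP.m≤n+m _ r′) (ℕP.≤-reflexive (sym r≡)))))
    where
    move : ∀ (r r′ e d : ℤ) → r′ ≡ r + e * d → r ≡ r′ + (- e) * d
    move r r′ e d refl = solve (r ∷ e ∷ d ∷ [])
    r≡ : r ≡ r′ ℕ.+ suc k ℕ.* d
    r≡ = +-injective (trans (move (+ r) (+ r′) -[1+ k ] (+ d) eq)
                            (trans (cong (_+_ (+ r′)) (sym (pos-* (suc k) d))) (sym (pos-+ r′ _))))

  divMod-unique : ∀ (n : ℤ) d .{{_ : NonZero d}} (r : ℕ) (q : ℤ) → r ℕ.< d → n ≡ + r + q * + d →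
                  n %ℕ d ≡ r × n /ℕ d ≡ q
  divMod-unique n d r q r<d n≡ = +-injective (+-cancelʳ (q′ * + d) (+ r′) (+ r) r′≡r) , q′≡q
    where
    r′ = n %ℕ d
    q′ = n /ℕ d
    n≡′ : n ≡ + r′ + q′ * + d
    n≡′ = a≡a%ℕn+[a/ℕn]*n n d
    difference : ∀ (r q r′ q′ d : ℤ) → r′ + q′ * d ≡ r + q * d → r′ ≡ r + (q - q′) * d
    difference r q r′ q′ d eq = begin
      r′                      ≡⟨ solve (r′ ∷ q′ ∷ d ∷ []) ⟩
      r′ + q′ * d - q′ * d    ≡⟨ cong (_- q′ * d) eq ⟩
      r + q * d - q′ * d      ≡⟨ solve (r ∷ q ∷ q′ ∷ d ∷ []) ⟩
      r + (q - q′) * d        ∎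
    q′≡q : q′ ≡ q
    q′≡q = sym (i-j≡0⇒i≡j q q′ (residue-offset≡0 (q - q′) d r r′ r<d (n%ℕd<d n d)
                                  (difference (+ r) q (+ r′) q′ (+ d) (trans (sym n≡′) n≡))))
    r′≡r : + r′ + q′ * + d ≡ + r + q′ * + d
    r′≡r = trans (sym n≡′) (trans n≡ (cong (λ z → + r + z * + d) (sym q′≡q)))

  %ℕ-unique : ∀ (n : ℤ) d .{{_ : NonZero d}} (r : ℕ) (q : ℤ) → r ℕ.< d → n ≡ + r + q * + d → n %ℕ d ≡ r
  %ℕ-unique n d r q r<d n≡ = proj₁ (divMod-unique n d r q r<d n≡)

  %ℕ-cong : ∀ {n} (m q : ℤ) d .{{_ : NonZero d}} → n ≡ m + q * + d → n %ℕ d ≡ m %ℕ d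
  %ℕ-cong {n} m q d n≡ = %ℕ-unique n d (m %ℕ d) (m /ℕ d + q) (n%ℕd<d m d) (begin
    n                                          ≡⟨ n≡ ⟩
    m + q * + d                                ≡⟨ cong (_+ q * + d) (a≡a%ℕn+[a/ℕn]*n m d) ⟩
    + (m %ℕ d) + m /ℕ d * + d + q * + d        ≡⟨ regroup (+ (m %ℕ d)) (m /ℕ d) q (+ d) ⟩
    + (m %ℕ d) + (m /ℕ d + q) * + d            ∎)
    where
    regroup : ∀ (r q q′ d : ℤ) → r + q * d + q′ * d ≡ r + (q + q′) * d
    regroup = solve-∀

  r<d⇒r%ℕd≡r : ∀ {r} d .{{_ : NonZero d}} → r ℕ.< d → (+ r) %ℕ d ≡ r
  r<d⇒r%ℕd≡r {r} d r<d = %ℕ-unique (+ r) d r 0ℤ r<d (sym (+-identityʳ (+ r)))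

  %ℕ-*-%ℕ : ∀ (x y : ℤ) d .{{_ : NonZero d}} → (x * + (y %ℕ d)) %ℕ d ≡ (x * y) %ℕ d
  %ℕ-*-%ℕ x y d = sym (%ℕ-cong (x * + (y %ℕ d)) (x * (y /ℕ d)) d (begin
    x * y                                      ≡⟨ cong (x *_) (a≡a%ℕn+[a/ℕn]*n y d) ⟩
    x * (+ (y %ℕ d) + y /ℕ d * + d)            ≡⟨ distrib x (+ (y %ℕ d)) (y /ℕ d) (+ d) ⟩
    x * + (y %ℕ d) + x * (y /ℕ d) * + d        ∎))
    where
    distrib : ∀ (x r q d : ℤ) → x * (r + q * d) ≡ x * r + x * q * d
    distrib = solve-∀

  %ℕ-%ℕ-* : ∀ (x y : ℤ) d .{{_ : NonZero d}} → (+ (y %ℕ d) * x) %ℕ d ≡ (y * x) %ℕ d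
  %ℕ-%ℕ-* x y d rewrite *-comm (+ (y %ℕ d)) x | *-comm y x = %ℕ-*-%ℕ x y d

  r%ℕd≢0 : ∀ {r} d .{{_ : NonZero d}} → 0 ℕ.< r → r ℕ.< d → (+ r) %ℕ d ≢ 0
  r%ℕd≢0 d 0<r r<d r%d≡0 = ℕP.<⇒≢ 0<r (sym (trans (sym (r<d⇒r%ℕd≡r d r<d)) r%d≡0))

  -- Units modulo d

  data InverseMod (d : ℕ) (x y : ℤ) : Set where
    mkInverseMod : (q : ℤ) → x * y ≡ 1ℤ + q * + d → InverseMod d x y

  inverseMod-comm : ∀ {d x y} → InverseMod d x y → InverseMod d y x
  inverseMod-comm {x = x} {y} (mkInverseMod q xy≡) = mkInverseMod q (trans (*-comm y x) xy≡)

  inverseMod-* : ∀ {d x x′ y y′} → InverseMod d x x′ → InverseMod d y y′ → InverseMod d (x * y) (x′ * y′)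
  inverseMod-* {d} {x} {x′} {y} {y′} (mkInverseMod q xx′≡) (mkInverseMod p yy′≡) = mkInverseMod (q + p + q * p * + d) (begin
    (x * y) * (x′ * y′)              ≡⟨ solve (x ∷ y ∷ x′ ∷ y′ ∷ []) ⟩
    (x * x′) * (y * y′)              ≡⟨ cong₂ _*_ xx′≡ yy′≡ ⟩
    (1ℤ + q * + d) * (1ℤ + p * + d)  ≡⟨ expand q p (+ d) ⟩
    1ℤ + (q + p + q * p * + d) * + d ∎)
    where
    expand : ∀ (q p d : ℤ) → (1ℤ + q * d) * (1ℤ + p * d) ≡ 1ℤ + (q + p + q * p * d) * d
    expand = solve-∀

  inverseMod-cancel : ∀ {d x y} .{{_ : NonZero d}} → InverseMod d x y → ∀ k → (x * (y * k)) %ℕ d ≡ k %ℕ d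
  inverseMod-cancel {d} {x} {y} (mkInverseMod q xy≡) k = %ℕ-cong k (q * k) d (begin
    x * (y * k)           ≡⟨ sym (*-assoc x y k) ⟩
    (x * y) * k           ≡⟨ cong (_* k) xy≡ ⟩
    (1ℤ + q * + d) * k    ≡⟨ expand q (+ d) k ⟩
    k + q * k * + d       ∎)
    where
    expand : ∀ (q d k : ℤ) → (1ℤ + q * d) * k ≡ k + q * k * d
    expand = solve-∀

  inverseMod-%ℕ≢0 : ∀ {d x y} .{{_ : NonZero d}} → InverseMod d y x →
                    ∀ {k} → 0 ℕ.< k → k ℕ.< d → (x * + k) %ℕ d ≢ 0
  inverseMod-%ℕ≢0 {d} {x} {y} yx≡1 {k} 0<k k<d xk%d≡0 = ℕP.<⇒≢ 0<k (sym (begin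
    k                          ≡⟨ sym (r<d⇒r%ℕd≡r d k<d) ⟩
    (+ k) %ℕ d                 ≡⟨ sym (inverseMod-cancel yx≡1 (+ k)) ⟩
    (y * (x * + k)) %ℕ d       ≡⟨ sym (%ℕ-*-%ℕ y (x * + k) d) ⟩
    (y * + ((x * + k) %ℕ d)) %ℕ d ≡⟨ cong (λ r → (y * + r) %ℕ d) xk%d≡0 ⟩
    (y * 0ℤ) %ℕ d              ≡⟨ cong (_%ℕ d) (*-zeroʳ y) ⟩
    0ℤ %ℕ d                    ≡⟨ r<d⇒r%ℕd≡r d (ℕ.>-nonZero⁻¹ d) ⟩
    0                          ∎))

  ∣⇒inverseMod : ∀ {d} x y → + d ℤ∣.∣ x * y - 1ℤ → InverseMod d x y
  ∣⇒inverseMod {d} x y d∣xy-1 with ∣ᵤ⇒∣ d∣xy-1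
  ... | divides q xy-1≡qd = mkInverseMod q (move (x * y) (q * + d) xy-1≡qd)
    where
    move : ∀ (z w : ℤ) → z - 1ℤ ≡ w → z ≡ 1ℤ + w
    move z w refl = solve (z ∷ [])

  bézout⇒inverseMod : ∀ {m n} → Bézout.Identity 1 m n → ∃[ y ] InverseMod n (+ m) y
  bézout⇒inverseMod {m} {n} (Bézout.+- x y 1+yn≡xm) = + x , mkInverseMod (+ y) (begin
    + m * + x         ≡⟨ *-comm (+ m) (+ x) ⟩
    + x * + m         ≡⟨ sym (pos-* x m) ⟩
    + (x ℕ.* m)       ≡⟨ cong +_ (sym 1+yn≡xm) ⟩
    + (1 ℕ.+ y ℕ.* n) ≡⟨ cong (_+_ 1ℤ) (pos-* y n) ⟩
    1ℤ + + y * + n    ∎)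
  bézout⇒inverseMod {m} {n} (Bézout.-+ x y 1+xm≡yn) = - + x , mkInverseMod (- + y) (begin
    + m * - + x             ≡⟨ negate (+ m) (+ x) ⟩
    1ℤ - (1ℤ + + x * + m)   ≡⟨ cong (_-_ 1ℤ) cast ⟩
    1ℤ - + y * + n          ≡⟨ regroup (+ y) (+ n) ⟩
    1ℤ + - + y * + n        ∎)
    where
    cast : 1ℤ + + x * + m ≡ + y * + n
    cast = trans (cong (_+_ 1ℤ) (sym (pos-* x m))) (trans (cong +_ 1+xm≡yn) (pos-* y n))
    negate : ∀ m x → m * - x ≡ 1ℤ - (1ℤ + x * m)
    negate = solve-∀
    regroup : ∀ y n → 1ℤ - y * n ≡ 1ℤ + - y * n
    regroup = solve-∀

  coprime⇒inverseMod : ∀ m n → gcd m n ≡ 1 → ∃[ y ] InverseMod n (+ m) y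
  coprime⇒inverseMod m n gcd≡1 = bézout⇒inverseMod (coprime-Bézout (gcd≡1⇒coprime gcd≡1))

  inverseMod-neg : ∀ {d x y} → InverseMod d x y → InverseMod d (- x) (- y)
  inverseMod-neg {x = x} {y} (mkInverseMod q xy≡) = mkInverseMod q (trans (neg*neg x y) xy≡)
    where
    neg*neg : ∀ x y → - x * - y ≡ x * y
    neg*neg = solve-∀

  cast-m²+1 : ∀ {m u t} → m ℕ.* m ℕ.+ 1 ≡ u ℕ.* t → + m * + m + 1ℤ ≡ + u * + t
  cast-m²+1 {m} {u} {t} m²+1≡ut =
    trans (cong (_+ 1ℤ) (sym (pos-* m m))) (trans (sym (pos-+ (m ℕ.* m) 1)) (trans (cong +_ m²+1≡ut) (pos-* u t)))

  ∣m²+1⇒inverseMod : ∀ {m t} → t ℕ∣.∣ m ℕ.* m ℕ.+ 1 → ∃[ u ] InverseMod m (+ t) u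
  ∣m²+1⇒inverseMod {m} {t} (ℕ∣.divides u m²+1≡ut) =
    + u , mkInverseMod (+ m) (trans (*-comm (+ t) (+ u)) (trans (sym (cast-m²+1 {m} {u} {t} m²+1≡ut)) (+-comm (+ m * + m) 1ℤ)))

  ∣m²+1⇒inverseMod-neg : ∀ {m t} → t ℕ∣.∣ m ℕ.* m ℕ.+ 1 → InverseMod t (+ m) (- + m)
  ∣m²+1⇒inverseMod-neg {m} {t} (ℕ∣.divides u m²+1≡ut) = mkInverseMod (- + u) (begin
    + m * - + m              ≡⟨ negate (+ m) ⟩
    1ℤ - (+ m * + m + 1ℤ)    ≡⟨ cong (_-_ 1ℤ) (cast-m²+1 {m} {u} {t} m²+1≡ut) ⟩
    1ℤ - + u * + t           ≡⟨ regroup (+ u) (+ t) ⟩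
    1ℤ + - + u * + t         ∎)
    where
    negate : ∀ m → m * - m ≡ 1ℤ - (m * m + 1ℤ)
    negate = solve-∀
    regroup : ∀ u t → 1ℤ - u * t ≡ 1ℤ + - u * t
    regroup = solve-∀

  -- Reindexing sums over residues

  Σ<-rotate : ∀ a .{{_ : NonZero a}} (q : ℤ) (f : ℕ → ℤ) → Σ[ i < a ] f ((q + + i) %ℕ a) ≡ Σ< a f
  Σ<-rotate a q f = trans (G≡G0 q) G0≡
    where
    G : ℤ → ℤ
    G q = Σ[ i < a ] f ((q + + i) %ℕ a)
    G0≡ : G 0ℤ ≡ Σ< a f
    G0≡ = Σ<-cong a (λ i i<a → cong f (trans (cong (_%ℕ a) (+-identityˡ (+ i))) (r<d⇒r%ℕd≡r a i<a)))
    G-suc : ∀ q → G (q + 1ℤ) ≡ G q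
    G-suc q = +-cancelʳ (f (q %ℕ a)) _ _ (begin
      G (q + 1ℤ) + f (q %ℕ a)      ≡⟨ cong₂ _+_ (Σ<-cong a (λ i _ → cong (λ z → f (z %ℕ a)) (+1+i i)))
                                                (cong (λ z → f (z %ℕ a)) (sym (+-identityʳ q))) ⟩
      Σ[ i < a ] h (suc i) + h 0   ≡⟨ Σ<-shift a h ⟩
      G q + h a                    ≡⟨ cong (λ z → G q + f z) (%ℕ-cong q 1ℤ a (cong (_+_ q) (sym (*-identityˡ (+ a))))) ⟩
      G q + f (q %ℕ a)             ∎)
      where
      h : ℕ → ℤ
      h i = f ((q + + i) %ℕ a)
      +1+i : ∀ i → q + 1ℤ + + i ≡ q + + suc i
      +1+i i = trans (+-assoc q 1ℤ (+ i)) (cong (_+_ q) (sym (pos-+ 1 i)))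
    G≡G0 : ∀ q → G q ≡ G 0ℤ
    G≡G0 (+ zero)          = refl
    G≡G0 +[1+ n ]          = trans (cong G (trans (cong +_ (ℕP.+-comm 1 n)) (pos-+ n 1)))
                                   (trans (G-suc (+ n)) (G≡G0 (+ n)))
    G≡G0 -[1+ zero ]       = sym (G-suc -[1+ zero ])
    G≡G0 -[1+ suc n ]      = trans (sym (G-suc -[1+ suc n ])) (G≡G0 -[1+ n ])

  Σ<-rotate⁻ : ∀ a .{{_ : NonZero a}} (q : ℤ) (f : ℕ → ℤ) → Σ[ i < a ] f ((q - + i) %ℕ a) ≡ Σ< a f
  Σ<-rotate⁻ a q f = begin
    Σ[ i < a ] f ((q - + i) %ℕ a)                   ≡⟨ sym (Σ<-reverse a (λ i → f ((q - + i) %ℕ a))) ⟩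
    Σ[ i < a ] f ((q - + (a ℕ.∸ suc i)) %ℕ a)       ≡⟨ Σ<-cong a (λ i i<a → cong (λ z → f (z %ℕ a)) (reflect i<a)) ⟩
    Σ[ i < a ] f ((q - + a + 1ℤ + + i) %ℕ a)        ≡⟨ Σ<-rotate a (q - + a + 1ℤ) f ⟩
    Σ< a f                                          ∎
    where
    regroup : ∀ (q a i : ℤ) → q - (a - (1ℤ + i)) ≡ q - a + 1ℤ + i
    regroup = solve-∀
    reflect : ∀ {i} → i ℕ.< a → q - + (a ℕ.∸ suc i) ≡ q - + a + 1ℤ + + i
    reflect {i} i<a = begin
      q - + (a ℕ.∸ suc i)      ≡⟨ cong (_-_ q) (sym (⊖-≥ i<a)) ⟩
      q - (a ⊖ suc i)          ≡⟨ cong (_-_ q) (sym (m-n≡m⊖n a (suc i))) ⟩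
      q - (+ a - + suc i)      ≡⟨ cong (λ z → q - (+ a - z)) (pos-+ 1 i) ⟩
      q - (+ a - (1ℤ + + i))   ≡⟨ regroup q (+ a) (+ i) ⟩
      q - + a + 1ℤ + + i       ∎

  %ℕ-split : ∀ a M D .{{_ : NonZero a}} .{{_ : NonZero M}} .{{_ : NonZero D}} → D ≡ a ℕ.* M →
             ∀ {r} → r ℕ.< M → (z : ℤ) → (+ r + z * + M) %ℕ D ≡ r ℕ.+ (z %ℕ a) ℕ.* M
  %ℕ-split a M D D≡aM {r} r<M z = %ℕ-unique (+ r + z * + M) D (r ℕ.+ s ℕ.* M) (z /ℕ a) bound (begin
    + r + z * + M                              ≡⟨ cong (λ w → + r + w * + M) (a≡a%ℕn+[a/ℕn]*n z a) ⟩
    + r + (+ s + z /ℕ a * + a) * + M           ≡⟨ regroup (+ r) (+ s) (z /ℕ a) (+ a) (+ M) ⟩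
    + r + + s * + M + z /ℕ a * (+ a * + M)     ≡⟨ cong₂ (λ u v → + r + u + z /ℕ a * v) (sym (pos-* s M))
                                                        (trans (sym (pos-* a M)) (cong +_ (sym D≡aM))) ⟩
    + r + + (s ℕ.* M) + z /ℕ a * + D           ≡⟨ cong (_+ z /ℕ a * + D) (sym (pos-+ r (s ℕ.* M))) ⟩
    + (r ℕ.+ s ℕ.* M) + z /ℕ a * + D           ∎)
    where
    s = z %ℕ a
    bound : r ℕ.+ s ℕ.* M ℕ.< D
    bound = subst (r ℕ.+ s ℕ.* M ℕ.<_) (sym D≡aM)
                  (ℕP.≤-trans (ℕP.+-monoˡ-< (s ℕ.* M) r<M) (ℕP.*-monoˡ-≤ M (n%ℕd<d z a)))
    regroup : ∀ (r s q a M : ℤ) → r + (s + q * a) * M ≡ r + s * M + q * (a * M)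
    regroup = solve-∀

  Σ<-split⁺ : ∀ a M D .{{_ : NonZero a}} .{{_ : NonZero M}} .{{_ : NonZero D}} → D ≡ a ℕ.* M →
             (n : ℤ) (F : ℕ → ℤ) →
             Σ[ i < a ] F ((n + + i * + M) %ℕ D) ≡ Σ[ m < a ] F (n %ℕ M ℕ.+ m ℕ.* M)
  Σ<-split⁺ a M D D≡aM n F =
    trans (Σ<-cong a (λ i _ → cong F (trans (cong (_%ℕ D) (regroup i))
                                             (%ℕ-split a M D D≡aM (n%ℕd<d n M) (n /ℕ M + + i)))))
          (Σ<-rotate a (n /ℕ M) (λ m → F (n %ℕ M ℕ.+ m ℕ.* M)))
    where
    regroup : ∀ i → n + + i * + M ≡ + (n %ℕ M) + (n /ℕ M + + i) * + M
    regroup i = trans (cong (_+ + i * + M) (a≡a%ℕn+[a/ℕn]*n n M)) (lemma (+ (n %ℕ M)) (n /ℕ M) (+ i) (+ M))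
      where
      lemma : ∀ (r q i M : ℤ) → r + q * M + i * M ≡ r + (q + i) * M
      lemma = solve-∀

  Σ<-split⁻ : ∀ a M D .{{_ : NonZero a}} .{{_ : NonZero M}} .{{_ : NonZero D}} → D ≡ a ℕ.* M →
              (n : ℤ) (F : ℕ → ℤ) →
              Σ[ i < a ] F ((n - + i * + M) %ℕ D) ≡ Σ[ m < a ] F (n %ℕ M ℕ.+ m ℕ.* M)
  Σ<-split⁻ a M D D≡aM n F =
    trans (Σ<-cong a (λ i _ → cong F (trans (cong (_%ℕ D) (regroup i))
                                             (%ℕ-split a M D D≡aM (n%ℕd<d n M) (n /ℕ M - + i)))))
          (Σ<-rotate⁻ a (n /ℕ M) (λ m → F (n %ℕ M ℕ.+ m ℕ.* M)))
    where
    regroup : ∀ i → n - + i * + M ≡ + (n %ℕ M) + (n /ℕ M - + i) * + M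
    regroup i = trans (cong (_- + i * + M) (a≡a%ℕn+[a/ℕn]*n n M)) (lemma (+ (n %ℕ M)) (n /ℕ M) (+ i) (+ M))
      where
      lemma : ∀ (r q i M : ℤ) → r + q * M - i * M ≡ r + (q - i) * M
      lemma = solve-∀

  δ : ℕ → ℕ → ℤ
  δ x y with x ℕ.≟ y
  ... | yes _ = 1ℤ
  ... | no  _ = 0ℤ

  δ-cong : ∀ {x y u v} → (x ≡ y → u ≡ v) → (u ≡ v → x ≡ y) → δ x y ≡ δ u v
  δ-cong {x} {y} {u} {v} ⇒ ⇐ with x ℕ.≟ y | u ℕ.≟ v
  ... | yes _   | yes _   = refl
  ... | no  _   | no  _   = refl
  ... | yes x≡y | no  u≢v = ⊥-elim (u≢v (⇒ x≡y))
  ... | no  x≢y | yes u≡v = ⊥-elim (x≢y (⇐ u≡v))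

  Σ<-δ-≥ : ∀ n x (F : ℕ → ℤ) → n ℕ.≤ x → Σ[ m < n ] (δ x m * F m) ≡ 0ℤ
  Σ<-δ-≥ zero    x F _ = refl
  Σ<-δ-≥ (suc n) x F n<x with x ℕ.≟ n
  ... | yes refl = ⊥-elim (ℕP.<-irrefl refl n<x)
  ... | no  _    = trans (cong (_+ 0ℤ * F n) (Σ<-δ-≥ n x F (ℕP.<⇒≤ n<x))) refl

  Σ<-δ : ∀ n x (F : ℕ → ℤ) → x ℕ.< n → Σ[ m < n ] (δ x m * F m) ≡ F x
  Σ<-δ (suc n) x F x<1+n with x ℕ.≟ n
  ... | yes refl = trans (cong (_+ 1ℤ * F n) (Σ<-δ-≥ n n F ℕP.≤-refl)) (trans (+-identityˡ _) (*-identityˡ (F n)))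
  ... | no  x≢n  = trans (cong (_+ 0ℤ * F n) (Σ<-δ n x F (ℕP.≤∧≢⇒< (ℕ.s≤s⁻¹ x<1+n) x≢n))) (+-identityʳ (F x))

  Σ<-permute : ∀ n .{{_ : NonZero n}} {h h′} → InverseMod n h′ h → (F : ℕ → ℤ) →
               Σ[ k < n ] F ((h * + k) %ℕ n) ≡ Σ< n F
  Σ<-permute n {h} {h′} h′h≡1 F = begin
    Σ[ k < n ] F (σ k)                               ≡⟨ Σ<-cong n (λ k _ → sym (Σ<-δ n (σ k) F (n%ℕd<d (h * + k) n))) ⟩
    Σ[ k < n ] Σ[ m < n ] (δ (σ k) m * F m)          ≡⟨ Σ<-comm n n (λ k m → δ (σ k) m * F m) ⟩
    Σ[ m < n ] Σ[ k < n ] (δ (σ k) m * F m)          ≡⟨ Σ<-cong n (λ m _ → Σ<-*ʳ n (F m) (λ k → δ (σ k) m)) ⟩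
    Σ[ m < n ] (Σ[ k < n ] δ (σ k) m * F m)          ≡⟨ Σ<-cong n (λ m m<n → cong (_* F m) (σ-hits-once m<n)) ⟩
    Σ[ m < n ] (1ℤ * F m)                            ≡⟨ Σ<-cong n (λ m _ → *-identityˡ (F m)) ⟩
    Σ< n F                                           ∎
    where
    σ τ : ℕ → ℕ
    σ k = (h * + k) %ℕ n
    τ m = (h′ * + m) %ℕ n
    undo : ∀ {x y} → InverseMod n x y → ∀ {k} → k ℕ.< n → (x * + ((y * + k) %ℕ n)) %ℕ n ≡ k
    undo {x} {y} xy≡1 {k} k<n =
      trans (%ℕ-*-%ℕ x (y * + k) n) (trans (inverseMod-cancel xy≡1 (+ k)) (r<d⇒r%ℕd≡r n k<n))
    σ⇒τ : ∀ {k m} → k ℕ.< n → σ k ≡ m → τ m ≡ k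
    σ⇒τ k<n σk≡m = trans (cong (λ z → (h′ * + z) %ℕ n) (sym σk≡m)) (undo h′h≡1 k<n)
    τ⇒σ : ∀ {k m} → m ℕ.< n → τ m ≡ k → σ k ≡ m
    τ⇒σ m<n τm≡k = trans (cong σ (sym τm≡k)) (undo (inverseMod-comm h′h≡1) m<n)
    σ-hits-once : ∀ {m} → m ℕ.< n → Σ[ k < n ] δ (σ k) m ≡ 1ℤ
    σ-hits-once {m} m<n = begin
      Σ[ k < n ] δ (σ k) m          ≡⟨ Σ<-cong n (λ k k<n → trans (δ-cong (σ⇒τ k<n) (τ⇒σ m<n)) (sym (*-identityʳ _))) ⟩
      Σ[ k < n ] (δ (τ m) k * 1ℤ)   ≡⟨ Σ<-δ n (τ m) (λ _ → 1ℤ) (n%ℕd<d (h′ * + m) n) ⟩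
      1ℤ                            ∎

  -- Centred residues

  -- P d (n mod d) is 2d((n/d)) for d ∤ n but -d at multiples of d, where P₀ gives the correct value 0.
  P : ℕ → ℕ → ℤ
  P d r = + 2 * + r - + d

  Pmod : (d : ℕ) .{{_ : NonZero d}} → ℤ → ℤ
  Pmod d n = P d (n %ℕ d)

  P-progression : ∀ D r m M → P D (r ℕ.+ m ℕ.* M) ≡ P D r + (+ 2 * + M) * + m
  P-progression D r m M = begin
    + 2 * + (r ℕ.+ m ℕ.* M) - + D      ≡⟨ cong (λ z → + 2 * z - + D) (trans (pos-+ r (m ℕ.* M)) (cong (_+_ (+ r)) (pos-* m M))) ⟩
    + 2 * (+ r + + m * + M) - + D      ≡⟨ expand (+ r) (+ m) (+ M) (+ D) ⟩
    P D r + (+ 2 * + M) * + m          ∎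
    where
    expand : ∀ (r m M D : ℤ) → + 2 * (r + m * M) - D ≡ + 2 * r - D + (+ 2 * M) * m
    expand = solve-∀

  Σ<-P : ∀ n M D r → D ≡ n ℕ.* M → Σ[ m < n ] P D (r ℕ.+ m ℕ.* M) ≡ + n * P M r
  Σ<-P n M D r D≡nM = *-cancelˡ-≡ (+ 2) _ _ (begin
    + 2 * Σ[ m < n ] P D (r ℕ.+ m ℕ.* M)            ≡⟨ cong (+ 2 *_) (Σ<-cong n (λ m _ → P-progression D r m M)) ⟩
    + 2 * Σ[ m < n ] (P D r + + 2 * + M * + m)      ≡⟨ Σ<-linear n (P D r) (+ 2 * + M) ⟩
    + n * (+ 2 * P D r + + 2 * + M * (+ n - 1ℤ))    ≡⟨ simplify (+ n) (+ r) (+ M) (trans (cong +_ D≡nM) (pos-* n M)) ⟩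
    + 2 * (+ n * P M r)                             ∎)
    where
    simplify : ∀ (n r M : ℤ) {D} → D ≡ n * M →
               n * (+ 2 * (+ 2 * r - D) + + 2 * M * (n - 1ℤ)) ≡ + 2 * (n * (+ 2 * r - M))
    simplify n r M refl = solve (n ∷ r ∷ M ∷ [])

  Σ<-P² : ∀ n M D r → D ≡ n ℕ.* M →
          + 3 * Σ[ m < n ] (P D (r ℕ.+ m ℕ.* M) * P D (r ℕ.+ m ℕ.* M))
            ≡ + 3 * + n * (P M r * P M r) + + n * (+ M * + M) * (+ n * + n - 1ℤ)
  Σ<-P² n M D r D≡nM = *-cancelˡ-≡ (+ 2) _ _ (begin
    + 2 * (+ 3 * Σ[ m < n ] (P D (r ℕ.+ m ℕ.* M) * P D (r ℕ.+ m ℕ.* M)))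
      ≡⟨ sym (*-assoc (+ 2) (+ 3) _) ⟩
    + 6 * Σ[ m < n ] (P D (r ℕ.+ m ℕ.* M) * P D (r ℕ.+ m ℕ.* M))
      ≡⟨ cong (+ 6 *_) (Σ<-cong n (λ m _ → cong₂ _*_ (P-progression D r m M) (P-progression D r m M))) ⟩
    + 6 * Σ[ m < n ] ((P D r + + 2 * + M * + m) * (P D r + + 2 * + M * + m))
      ≡⟨ Σ<-square n (P D r) (+ 2 * + M) ⟩
    + n * (+ 6 * P D r * P D r + + 6 * P D r * (+ 2 * + M) * (+ n - 1ℤ)
           + + 2 * + M * (+ 2 * + M) * (+ n - 1ℤ) * (+ 2 * + n - 1ℤ))
      ≡⟨ simplify (+ n) (+ r) (+ M) (trans (cong +_ D≡nM) (pos-* n M)) ⟩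
    + 2 * (+ 3 * + n * (P M r * P M r) + + n * (+ M * + M) * (+ n * + n - 1ℤ)) ∎)
    where
    simplify : ∀ (n r M : ℤ) {D} → D ≡ n * M →
      n * (+ 6 * (+ 2 * r - D) * (+ 2 * r - D) + + 6 * (+ 2 * r - D) * (+ 2 * M) * (n - 1ℤ)
           + + 2 * M * (+ 2 * M) * (n - 1ℤ) * (+ 2 * n - 1ℤ))
      ≡ + 2 * (+ 3 * n * ((+ 2 * r - M) * (+ 2 * r - M)) + n * (M * M) * (n * n - 1ℤ))
    simplify n r M refl = solve (n ∷ r ∷ M ∷ [])

  Σ<-P²-complete : ∀ n → + 3 * Σ[ m < n ] (P n m * P n m) ≡ + n * (+ n * + n + + 2)
  Σ<-P²-complete n = begin
    + 3 * Σ[ m < n ] (P n m * P n m)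
      ≡⟨ cong (+ 3 *_) (Σ<-cong n (λ m _ → cong (λ z → P n z * P n z) (sym (ℕP.*-identityʳ m)))) ⟩
    + 3 * Σ[ m < n ] (P n (0 ℕ.+ m ℕ.* 1) * P n (0 ℕ.+ m ℕ.* 1))
      ≡⟨ Σ<-P² n 1 n 0 (sym (ℕP.*-identityʳ n)) ⟩
    + 3 * + n * (P 1 0 * P 1 0) + + n * (+ 1 * + 1) * (+ n * + n - 1ℤ)
      ≡⟨ simplify (+ n) ⟩
    + n * (+ n * + n + + 2) ∎
    where
    simplify : ∀ n → + 3 * n * (- 1ℤ * - 1ℤ) + n * (+ 1 * + 1) * (n * n - 1ℤ) ≡ n * (n * n + + 2)
    simplify = solve-∀

  P₀ : ℕ → ℕ → ℤ
  P₀ d zero    = 0ℤ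
  P₀ d (suc r) = P d (suc r)

  P₀mod : (d : ℕ) .{{_ : NonZero d}} → ℤ → ℤ
  P₀mod d n = P₀ d (n %ℕ d)

  P₀mod≡Pmod : ∀ d .{{_ : NonZero d}} {n} → n %ℕ d ≢ 0 → P₀mod d n ≡ Pmod d n
  P₀mod≡Pmod d {n} n%d≢0 with n %ℕ d
  ... | zero  = ⊥-elim (n%d≢0 refl)
  ... | suc r = refl

  P₀-pos : ∀ d {r} → 0 ℕ.< r → P₀ d r ≡ P d r
  P₀-pos d {suc r} _ = refl

  P₀mod-neg : ∀ d .{{_ : NonZero d}} n → P₀mod d (- n) ≡ - P₀mod d n
  P₀mod-neg d n with n %ℕ d in n%d≡ | a≡a%ℕn+[a/ℕn]*n n d
  ... | zero  | n≡ = cong (P₀ d) (trans (%ℕ-cong 0ℤ (- (n /ℕ d)) d (begin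
    - n                              ≡⟨ cong -_ n≡ ⟩
    - (0ℤ + n /ℕ d * + d)            ≡⟨ negate (n /ℕ d) (+ d) ⟩
    0ℤ + - (n /ℕ d) * + d            ∎)) (r<d⇒r%ℕd≡r d (ℕ.>-nonZero⁻¹ d)))
    where
    negate : ∀ (q d : ℤ) → - (0ℤ + q * d) ≡ 0ℤ + - q * d
    negate = solve-∀
  ... | suc r | n≡ = begin
    P₀ d ((- n) %ℕ d)              ≡⟨ cong (P₀ d) (%ℕ-unique (- n) d (d ℕ.∸ suc r) (- (n /ℕ d) - 1ℤ) d∸r<d -n≡) ⟩
    P₀ d (d ℕ.∸ suc r)             ≡⟨ P₀-pos d (ℕP.m<n⇒0<n∸m r<d) ⟩
    P d (d ℕ.∸ suc r)              ≡⟨ cong (λ z → + 2 * z - + d) (sym d-r≡) ⟩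
    + 2 * (+ d - + suc r) - + d    ≡⟨ reflect (+ d) (+ suc r) ⟩
    - P d (suc r)                  ∎
    where
    r<d : suc r ℕ.< d
    r<d = subst (ℕ._< d) n%d≡ (n%ℕd<d n d)
    d∸r<d : d ℕ.∸ suc r ℕ.< d
    d∸r<d = ℕP.∸-monoʳ-< (ℕ.s≤s ℕ.z≤n) (ℕP.<⇒≤ r<d)
    d-r≡ : + d - + suc r ≡ + (d ℕ.∸ suc r)
    d-r≡ = trans (m-n≡m⊖n d (suc r)) (⊖-≥ (ℕP.<⇒≤ r<d))
    reflect : ∀ (d s : ℤ) → + 2 * (d - s) - d ≡ - (+ 2 * s - d)
    reflect = solve-∀
    complement : ∀ (s q d : ℤ) → - (s + q * d) ≡ (d - s) + (- q - 1ℤ) * d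
    complement = solve-∀
    -n≡ : - n ≡ + (d ℕ.∸ suc r) + (- (n /ℕ d) - 1ℤ) * + d
    -n≡ = begin
      - n                                          ≡⟨ cong -_ n≡ ⟩
      - (+ suc r + n /ℕ d * + d)                   ≡⟨ complement (+ suc r) (n /ℕ d) (+ d) ⟩
      (+ d - + suc r) + (- (n /ℕ d) - 1ℤ) * + d    ≡⟨ cong (_+ (- (n /ℕ d) - 1ℤ) * + d) d-r≡ ⟩
      + (d ℕ.∸ suc r) + (- (n /ℕ d) - 1ℤ) * + d    ∎

  -- dedekindℤ h d = 4d² s(h, d), see Sawtooth.dedekind-/.
  dedekindℤ : ℤ → (d : ℕ) .{{_ : NonZero d}} → ℤ
  dedekindℤ h d = Σ[ k < d ] (P₀mod d (+ k) * P₀mod d (h * + k))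

  dedekindℤ-neg : ∀ h d .{{_ : NonZero d}} → dedekindℤ (- h) d ≡ - dedekindℤ h d
  dedekindℤ-neg h d = trans (Σ<-cong d (λ k _ → begin
      P₀mod d (+ k) * P₀mod d (- h * + k)       ≡⟨ cong (λ z → P₀mod d (+ k) * P₀mod d z) (sym (neg-distribˡ-* h (+ k))) ⟩
      P₀mod d (+ k) * P₀mod d (- (h * + k))     ≡⟨ cong (P₀mod d (+ k) *_) (P₀mod-neg d (h * + k)) ⟩
      P₀mod d (+ k) * - P₀mod d (h * + k)       ≡⟨ sym (neg-distribʳ-* (P₀mod d (+ k)) _) ⟩
      - (P₀mod d (+ k) * P₀mod d (h * + k))     ∎))
    (Σ<-neg d _)

  Σ<-Pmod-unit : ∀ d .{{_ : NonZero d}} {h h′} → InverseMod d h′ h →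
                 Σ[ k < d ] (Pmod d (+ k) * Pmod d (h * + k)) ≡ + d * + d + dedekindℤ h d
  Σ<-Pmod-unit (suc d) {h} h′h≡1 = begin
    Σ[ k < suc d ] (Pmod (suc d) (+ k) * Pmod (suc d) (h * + k))
      ≡⟨ Σ<-suc d _ ⟩
    Pmod (suc d) 0ℤ * Pmod (suc d) (h * 0ℤ) + Σ[ k < d ] (Pmod (suc d) (+ suc k) * Pmod (suc d) (h * + suc k))
      ≡⟨ cong₂ _+_ (cong (λ z → Pmod (suc d) 0ℤ * Pmod (suc d) z) (*-zeroʳ h)) (Σ<-cong d (λ k k<d → cong₂ _*_ (P₀≡P k<d) (hP₀≡hP k<d))) ⟩
    Pmod (suc d) 0ℤ * Pmod (suc d) 0ℤ + Σ[ k < d ] g (suc k)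
      ≡⟨ cong₂ _+_ (square (+ d)) (sym (trans (Σ<-suc d g) (+-identityˡ (Σ[ k < d ] g (suc k))))) ⟩
    + suc d * + suc d + dedekindℤ h (suc d)
      ∎
    where
    g : ℕ → ℤ
    g k = P₀mod (suc d) (+ k) * P₀mod (suc d) (h * + k)
    P₀≡P : ∀ {k} → k ℕ.< d → Pmod (suc d) (+ suc k) ≡ P₀mod (suc d) (+ suc k)
    P₀≡P {k} k<d = sym (P₀mod≡Pmod (suc d) {+ suc k} (r%ℕd≢0 (suc d) (ℕ.s≤s ℕ.z≤n) (ℕ.s≤s k<d)))
    hP₀≡hP : ∀ {k} → k ℕ.< d → Pmod (suc d) (h * + suc k) ≡ P₀mod (suc d) (h * + suc k)
    hP₀≡hP {k} k<d = sym (P₀mod≡Pmod (suc d) {h * + suc k} (inverseMod-%ℕ≢0 h′h≡1 (ℕ.s≤s ℕ.z≤n) (ℕ.s≤s k<d)))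
    square : ∀ d → (+ 2 * 0ℤ - (1ℤ + d)) * (+ 2 * 0ℤ - (1ℤ + d)) ≡ (1ℤ + d) * (1ℤ + d)
    square = solve-∀

  Σ<-Pmod-Pmod : ∀ d .{{_ : NonZero d}} {x x′ y y′} → InverseMod d x x′ → InverseMod d y y′ →
                 Σ[ j < d ] (Pmod d (+ j * x) * Pmod d (+ j * y)) ≡ + d * + d + dedekindℤ (x′ * y) d
  Σ<-Pmod-Pmod d {x} {x′} {y} {y′} xx′≡1 yy′≡1 = begin
    Σ[ j < d ] F j                                      ≡⟨ sym (Σ<-permute d xx′≡1 F) ⟩
    Σ[ k < d ] F ((x′ * + k) %ℕ d)                      ≡⟨ Σ<-cong d (λ k _ → cong₂ _*_ (cong (P d) (x-term k)) (cong (P d) (y-term k))) ⟩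
    Σ[ k < d ] (Pmod d (+ k) * Pmod d (x′ * y * + k))   ≡⟨ Σ<-Pmod-unit d (inverseMod-* xx′≡1 (inverseMod-comm yy′≡1)) ⟩
    + d * + d + dedekindℤ (x′ * y) d                    ∎
    where
    F : ℕ → ℤ
    F j = Pmod d (+ j * x) * Pmod d (+ j * y)
    x-term : ∀ k → (+ ((x′ * + k) %ℕ d) * x) %ℕ d ≡ (+ k) %ℕ d
    x-term k = begin
      (+ ((x′ * + k) %ℕ d) * x) %ℕ d     ≡⟨ %ℕ-%ℕ-* x (x′ * + k) d ⟩
      (x′ * + k * x) %ℕ d                ≡⟨ cong (_%ℕ d) (*-comm (x′ * + k) x) ⟩
      (x * (x′ * + k)) %ℕ d              ≡⟨ inverseMod-cancel xx′≡1 (+ k) ⟩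
      (+ k) %ℕ d                         ∎
    y-term : ∀ k → (+ ((x′ * + k) %ℕ d) * y) %ℕ d ≡ (x′ * y * + k) %ℕ d
    y-term k = trans (%ℕ-%ℕ-* y (x′ * + k) d) (cong (_%ℕ d) (*-right-comm x′ (+ k) y))

  Σ<-Pmod²-unit : ∀ M .{{_ : NonZero M}} {x x′} → InverseMod M x′ x →
                  + 3 * Σ[ j < M ] (Pmod M (+ j * x) * Pmod M (+ j * x)) ≡ + M * (+ M * + M + + 2)
  Σ<-Pmod²-unit M {x} x′x≡1 = begin
    + 3 * Σ[ j < M ] (Pmod M (+ j * x) * Pmod M (+ j * x))
      ≡⟨ cong (+ 3 *_) (Σ<-cong M (λ j _ → cong (λ z → Pmod M z * Pmod M z) (*-comm (+ j) x))) ⟩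
    + 3 * Σ[ j < M ] (Pmod M (x * + j) * Pmod M (x * + j))
      ≡⟨ cong (+ 3 *_) (Σ<-permute M x′x≡1 (λ r → P M r * P M r)) ⟩
    + 3 * Σ[ r < M ] (P M r * P M r)
      ≡⟨ Σ<-P²-complete M ⟩
    + M * (+ M * + M + + 2) ∎

  Σ<-grid-P² : ∀ n M .{{_ : NonZero M}} {x x′} → InverseMod M x′ x → (f : ℕ → ℕ → ℤ) →
               (∀ j → + 3 * Σ[ i < n ] (f i j * f i j)
                        ≡ + 3 * + n * (Pmod M (+ j * x) * Pmod M (+ j * x)) + + n * (+ M * + M) * (+ n * + n - 1ℤ)) →
               + 3 * Σ[ j < M ] Σ[ i < n ] (f i j * f i j) ≡ + n * + M * (+ n * + M * (+ n * + M) + + 2)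
  Σ<-grid-P² n M {x} x′x≡1 f column = begin
    + 3 * Σ[ j < M ] Σ[ i < n ] (f i j * f i j)       ≡⟨ sym (Σ<-*ˡ M (+ 3) _) ⟩
    Σ[ j < M ] (+ 3 * Σ[ i < n ] (f i j * f i j))     ≡⟨ Σ<-cong M (λ j _ → column j) ⟩
    Σ[ j < M ] (+ 3 * + n * Q j + K)                  ≡⟨ Σ<-+ M _ _ ⟩
    Σ[ j < M ] (+ 3 * + n * Q j) + Σ[ j < M ] K       ≡⟨ cong₂ _+_ (Σ<-*ˡ M (+ 3 * + n) Q) (Σ<-const M K) ⟩
    + 3 * + n * Σ< M Q + + M * K                      ≡⟨ cong (_+ + M * K) (*-right-comm (+ 3) (+ n) _) ⟩
    + 3 * Σ< M Q * + n + + M * K                      ≡⟨ cong (λ z → z * + n + + M * K) (Σ<-Pmod²-unit M x′x≡1) ⟩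
    + M * (+ M * + M + + 2) * + n + + M * K           ≡⟨ simplify (+ n) (+ M) ⟩
    + n * + M * (+ n * + M * (+ n * + M) + + 2)       ∎
    where
    Q : ℕ → ℤ
    Q j = Pmod M (+ j * x) * Pmod M (+ j * x)
    K : ℤ
    K = + n * (+ M * + M) * (+ n * + n - 1ℤ)
    simplify : ∀ n M → M * (M * M + + 2) * n + M * (n * (M * M) * (n * n - 1ℤ)) ≡ n * M * (n * M * (n * M) + + 2)
    simplify = solve-∀

  -- The three-term relation

  bounded-multiple : ∀ {A B T : ℕ} (m : ℤ) → A ℕ.< T ℕ.+ T → B ℕ.< T → + A ≡ + B + + T * m → m ≡ 0ℤ ⊎ m ≡ 1ℤ
  bounded-multiple (+ 0) _ _ _ = inj₁ refl
  bounded-multiple (+ 1) _ _ _ = inj₂ refl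
  bounded-multiple {A} {B} {T} (+ suc (suc k)) A<2T _ A≡ =
    ⊥-elim (ℕP.<⇒≱ A<2T (ℕP.≤-trans 2T≤ (ℕP.≤-trans (ℕP.m≤n+m _ B) (ℕP.≤-reflexive (sym A≡B+Tm)))))
    where
    A≡B+Tm : A ≡ B ℕ.+ T ℕ.* suc (suc k)
    A≡B+Tm = +-injective (trans A≡ (sym (trans (pos-+ B _) (cong (_+_ (+ B)) (pos-* T (suc (suc k)))))))
    2T≤ : T ℕ.+ T ℕ.≤ T ℕ.* suc (suc k)
    2T≤ = ℕP.≤-trans (ℕP.+-monoʳ-≤ T (ℕP.m≤m*n T (suc k))) (ℕP.≤-reflexive (sym (ℕP.*-suc T (suc k))))
  bounded-multiple {A} {B} {T} -[1+ k ] _ B<T A≡ =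
    ⊥-elim (ℕP.<⇒≱ B<T (ℕP.≤-trans (ℕP.m≤m*n T (suc k)) (ℕP.≤-trans (ℕP.m≤n+m _ A) (ℕP.≤-reflexive (sym B≡A+Tm)))))
    where
    move : ∀ (A B T m : ℤ) → A ≡ B + T * - m → B ≡ A + T * m
    move A B T m refl = solve (B ∷ T ∷ m ∷ [])
    B≡A+Tm : B ≡ A ℕ.+ T ℕ.* suc k
    B≡A+Tm = +-injective (trans (move (+ A) (+ B) (+ T) (+ suc k) A≡)
                                (sym (trans (pos-+ A _) (cong (_+_ (+ A)) (pos-* T (suc k))))))

  residue-combination : ∀ (a b c rX rY rW qX qY qW : ℤ) {X Y W} →
                        X ≡ rX + qX * (a * b) → Y ≡ rY + qY * (b * c) → W ≡ rW + qW * (a * c) → c * X + a * Y ≡ b * W →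
                        c * rX + a * rY ≡ b * rW + a * b * c * (qW - qX - qY)
  residue-combination a b c rX rY rW qX qY qW refl refl refl cX+aY≡bW = begin
    c * rX + a * rY                                                             ≡⟨ solve (a ∷ b ∷ c ∷ rX ∷ rY ∷ qX ∷ qY ∷ []) ⟩
    c * (rX + qX * (a * b)) + a * (rY + qY * (b * c)) - a * b * c * (qX + qY)   ≡⟨ cong (_- a * b * c * (qX + qY)) cX+aY≡bW ⟩
    b * (rW + qW * (a * c)) - a * b * c * (qX + qY)                             ≡⟨ solve (a ∷ b ∷ c ∷ rW ∷ qX ∷ qY ∷ qW ∷ []) ⟩
    b * rW + a * b * c * (qW - qX - qY)                                         ∎

  centred-combination : ∀ (a b c rX rY rW : ℤ) {ab bc ac} → ab ≡ a * b → bc ≡ b * c → ac ≡ a * c →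
                        c * (+ 2 * rX - ab) + a * (+ 2 * rY - bc) - b * (+ 2 * rW - ac)
                          ≡ + 2 * ((c * rX + a * rY) - b * rW) - a * b * c
  centred-combination a b c rX rY rW refl refl refl = solve (a ∷ b ∷ c ∷ rX ∷ rY ∷ rW ∷ [])

  ±T² : ∀ T m → m ≡ 0ℤ ⊎ m ≡ 1ℤ → (+ 2 * (T * m) - T) * (+ 2 * (T * m) - T) ≡ T * T
  ±T² T m (inj₁ refl) = square-at-0 T
    where
    square-at-0 : ∀ T → (+ 2 * (T * 0ℤ) - T) * (+ 2 * (T * 0ℤ) - T) ≡ T * T
    square-at-0 = solve-∀
  ±T² T m (inj₂ refl) = square-at-1 T
    where
    square-at-1 : ∀ T → (+ 2 * (T * 1ℤ) - T) * (+ 2 * (T * 1ℤ) - T) ≡ T * T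
    square-at-1 = solve-∀

  module Box (a b c : ℕ) {{_ : NonZero a}} {{_ : NonZero b}} {{_ : NonZero c}} where

    instance
      ab≢0 : NonZero (a ℕ.* b)
      ab≢0 = ℕP.m*n≢0 a b
      bc≢0 : NonZero (b ℕ.* c)
      bc≢0 = ℕP.m*n≢0 b c
      ac≢0 : NonZero (a ℕ.* c)
      ac≢0 = ℕP.m*n≢0 a c

    T : ℤ
    T = + a * + b * + c

    E : ℤ → ℤ → ℤ → ℤ
    E X Y W = + c * Pmod (a ℕ.* b) X + + a * Pmod (b ℕ.* c) Y - + b * Pmod (a ℕ.* c) W

    E²≡T² : ∀ X Y W → + c * X + + a * Y ≡ + b * W → E X Y W * E X Y W ≡ T * T
    E²≡T² X Y W cX+aY≡bW = trans (cong (λ e → e * e) E≡) (±T² T m (bounded-multiple m A<2T B<T A≡B+Tm))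
      where
      rX = X %ℕ (a ℕ.* b)
      rY = Y %ℕ (b ℕ.* c)
      rW = W %ℕ (a ℕ.* c)
      m = W /ℕ (a ℕ.* c) - X /ℕ (a ℕ.* b) - Y /ℕ (b ℕ.* c)
      A B T′ : ℕ
      A = c ℕ.* rX ℕ.+ a ℕ.* rY
      B = b ℕ.* rW
      T′ = a ℕ.* b ℕ.* c
      divMod : ∀ n d e .{{_ : NonZero (d ℕ.* e)}} → n ≡ + (n %ℕ (d ℕ.* e)) + n /ℕ (d ℕ.* e) * (+ d * + e)
      divMod n d e = trans (a≡a%ℕn+[a/ℕn]*n n (d ℕ.* e)) (cong (λ z → + (n %ℕ (d ℕ.* e)) + n /ℕ (d ℕ.* e) * z) (pos-* d e))
      residues : + c * + rX + + a * + rY ≡ + b * + rW + T * m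
      residues = residue-combination (+ a) (+ b) (+ c) (+ rX) (+ rY) (+ rW) (X /ℕ (a ℕ.* b)) (Y /ℕ (b ℕ.* c)) (W /ℕ (a ℕ.* c))
                                     (divMod X a b) (divMod Y b c) (divMod W a c) cX+aY≡bW
      A≡B+Tm : + A ≡ + B + + T′ * m
      A≡B+Tm = begin
        + (c ℕ.* rX ℕ.+ a ℕ.* rY)          ≡⟨ trans (pos-+ (c ℕ.* rX) (a ℕ.* rY)) (cong₂ _+_ (pos-* c rX) (pos-* a rY)) ⟩
        + c * + rX + + a * + rY            ≡⟨ residues ⟩
        + b * + rW + T * m                 ≡⟨ cong₂ (λ u v → u + v * m) (sym (pos-* b rW))
                                                    (trans (cong (_* + c) (sym (pos-* a b))) (sym (pos-* (a ℕ.* b) c))) ⟩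
        + (b ℕ.* rW) + + T′ * m            ∎
      A<2T : A ℕ.< T′ ℕ.+ T′
      A<2T = ℕP.+-mono-< (subst (c ℕ.* rX ℕ.<_) (ℕP.*-comm c (a ℕ.* b)) (ℕP.*-monoʳ-< c (n%ℕd<d X (a ℕ.* b))))
                         (subst (a ℕ.* rY ℕ.<_) (sym (ℕP.*-assoc a b c)) (ℕP.*-monoʳ-< a (n%ℕd<d Y (b ℕ.* c))))
      B<T : B ℕ.< T′
      B<T = subst (b ℕ.* rW ℕ.<_) (trans (sym (ℕP.*-assoc b a c)) (cong (ℕ._* c) (ℕP.*-comm b a)))
                  (ℕP.*-monoʳ-< b (n%ℕd<d W (a ℕ.* c)))
      E≡ : E X Y W ≡ + 2 * (T * m) - T
      E≡ = begin
        + c * P (a ℕ.* b) rX + + a * P (b ℕ.* c) rY - + b * P (a ℕ.* c) rW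
          ≡⟨ centred-combination (+ a) (+ b) (+ c) (+ rX) (+ rY) (+ rW) (pos-* a b) (pos-* b c) (pos-* a c) ⟩
        + 2 * ((+ c * + rX + + a * + rY) - + b * + rW) - T
          ≡⟨ cong (λ z → + 2 * (z - + b * + rW) - T) residues ⟩
        + 2 * ((+ b * + rW + T * m) - + b * + rW) - T
          ≡⟨ cancel (+ b * + rW) (T * m) T ⟩
        + 2 * (T * m) - T  ∎
        where
        cancel : ∀ (x y T : ℤ) → + 2 * ((x + y) - x) - T ≡ + 2 * y - T
        cancel = solve-∀

    Σ³ : (ℕ → ℕ → ℕ → ℤ) → ℤ
    Σ³ F = Σ[ i < a ] Σ[ j < b ] Σ[ k < c ] F i j k

    Σ³-cong : ∀ {F G : ℕ → ℕ → ℕ → ℤ} → (∀ i j k → F i j k ≡ G i j k) → Σ³ F ≡ Σ³ G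
    Σ³-cong F≗G = Σ<-cong a (λ i _ → Σ<-cong b (λ j _ → Σ<-cong c (λ k _ → F≗G i j k)))

    Σ³-+ : ∀ (F G : ℕ → ℕ → ℕ → ℤ) → Σ³ (λ i j k → F i j k + G i j k) ≡ Σ³ F + Σ³ G
    Σ³-+ F G = trans (Σ<-cong a (λ i _ → trans (Σ<-cong b (λ j _ → Σ<-+ c (F i j) (G i j))) (Σ<-+ b _ _))) (Σ<-+ a _ _)

    Σ³-*ˡ : ∀ (u : ℤ) (F : ℕ → ℕ → ℕ → ℤ) → Σ³ (λ i j k → u * F i j k) ≡ u * Σ³ F
    Σ³-*ˡ u F = trans (Σ<-cong a (λ i _ → trans (Σ<-cong b (λ j _ → Σ<-*ˡ c u (F i j))) (Σ<-*ˡ b u _))) (Σ<-*ˡ a u _)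

    Σ³-ij : ∀ (f : ℕ → ℕ → ℤ) → Σ³ (λ i j k → f i j) ≡ + c * Σ[ i < a ] Σ[ j < b ] f i j
    Σ³-ij f = trans (Σ<-cong a (λ i _ → trans (Σ<-cong b (λ j _ → Σ<-const c (f i j))) (Σ<-*ˡ b (+ c) (f i))))
                    (Σ<-*ˡ a (+ c) _)

    Σ³-jk : ∀ (g : ℕ → ℕ → ℤ) → Σ³ (λ i j k → g j k) ≡ + a * Σ[ j < b ] Σ[ k < c ] g j k
    Σ³-jk g = Σ<-const a _

    Σ³-ik : ∀ (h : ℕ → ℕ → ℤ) → Σ³ (λ i j k → h i k) ≡ + b * Σ[ i < a ] Σ[ k < c ] h i k
    Σ³-ik h = trans (Σ<-cong a (λ i _ → Σ<-const b _)) (Σ<-*ˡ a (+ b) _)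

    Σ³-ij·jk : ∀ (f g : ℕ → ℕ → ℤ) →
               Σ³ (λ i j k → f i j * g j k) ≡ Σ[ j < b ] (Σ[ i < a ] f i j * Σ[ k < c ] g j k)
    Σ³-ij·jk f g = begin
      Σ³ (λ i j k → f i j * g j k)                       ≡⟨ Σ<-cong a (λ i _ → Σ<-cong b (λ j _ → Σ<-*ˡ c (f i j) (g j))) ⟩
      Σ[ i < a ] Σ[ j < b ] (f i j * Σ< c (g j))         ≡⟨ Σ<-comm a b _ ⟩
      Σ[ j < b ] Σ[ i < a ] (f i j * Σ< c (g j))         ≡⟨ Σ<-cong b (λ j _ → Σ<-*ʳ a (Σ< c (g j)) (λ i → f i j)) ⟩
      Σ[ j < b ] (Σ[ i < a ] f i j * Σ[ k < c ] g j k)   ∎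

    Σ³-ij·ik : ∀ (f h : ℕ → ℕ → ℤ) →
               Σ³ (λ i j k → f i j * h i k) ≡ Σ[ i < a ] (Σ[ j < b ] f i j * Σ[ k < c ] h i k)
    Σ³-ij·ik f h = Σ<-cong a (λ i _ → trans (Σ<-cong b (λ j _ → Σ<-*ˡ c (f i j) (h i))) (Σ<-*ʳ b (Σ< c (h i)) (f i)))

    Σ³-jk·ik : ∀ (g h : ℕ → ℕ → ℤ) →
               Σ³ (λ i j k → g j k * h i k) ≡ Σ[ k < c ] (Σ[ j < b ] g j k * Σ[ i < a ] h i k)
    Σ³-jk·ik g h = begin
      Σ³ (λ i j k → g j k * h i k)                       ≡⟨ Σ<-cong a (λ i _ → Σ<-comm b c _) ⟩
      Σ[ i < a ] Σ[ k < c ] Σ[ j < b ] (g j k * h i k)   ≡⟨ Σ<-comm a c _ ⟩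
      Σ[ k < c ] Σ[ i < a ] Σ[ j < b ] (g j k * h i k)   ≡⟨ Σ<-cong c (λ k _ → Σ<-cong a (λ i _ → Σ<-*ʳ b (h i k) (λ j → g j k))) ⟩
      Σ[ k < c ] Σ[ i < a ] (Σ[ j < b ] g j k * h i k)   ≡⟨ Σ<-cong c (λ k _ → Σ<-*ˡ a (Σ[ j < b ] g j k) (λ i → h i k)) ⟩
      Σ[ k < c ] (Σ[ j < b ] g j k * Σ[ i < a ] h i k)   ∎

    px py pw : ℕ → ℕ → ℤ
    px i j = Pmod (a ℕ.* b) (+ i * + b + + j * + a)
    py j k = Pmod (b ℕ.* c) (+ j * - + c + + k * + b)
    pw i k = Pmod (a ℕ.* c) (+ i * + c + + k * + a)

    Σᵢ-px : ∀ j → Σ[ i < a ] px i j ≡ + a * Pmod b (+ j * + a)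
    Σᵢ-px j = begin
      Σ[ i < a ] px i j                                          ≡⟨ Σ<-cong a (λ i _ → cong (Pmod (a ℕ.* b)) (+-comm (+ i * + b) _)) ⟩
      Σ[ i < a ] Pmod (a ℕ.* b) (+ j * + a + + i * + b)          ≡⟨ Σ<-split⁺ a b (a ℕ.* b) refl (+ j * + a) (P (a ℕ.* b)) ⟩
      Σ[ m < a ] P (a ℕ.* b) ((+ j * + a) %ℕ b ℕ.+ m ℕ.* b)      ≡⟨ Σ<-P a b (a ℕ.* b) ((+ j * + a) %ℕ b) refl ⟩
      + a * Pmod b (+ j * + a)                                   ∎

    Σⱼ-px : ∀ i → Σ[ j < b ] px i j ≡ + b * Pmod a (+ i * + b)
    Σⱼ-px i = trans (Σ<-split⁺ b a (a ℕ.* b) (ℕP.*-comm a b) (+ i * + b) (P (a ℕ.* b)))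
                    (Σ<-P b a (a ℕ.* b) ((+ i * + b) %ℕ a) (ℕP.*-comm a b))

    Σⱼ-py : ∀ k → Σ[ j < b ] py j k ≡ + b * Pmod c (+ k * + b)
    Σⱼ-py k = begin
      Σ[ j < b ] py j k                                          ≡⟨ Σ<-cong b (λ j _ → cong (Pmod (b ℕ.* c)) (swap (+ j) (+ c) (+ k * + b))) ⟩
      Σ[ j < b ] Pmod (b ℕ.* c) (+ k * + b - + j * + c)          ≡⟨ Σ<-split⁻ b c (b ℕ.* c) refl (+ k * + b) (P (b ℕ.* c)) ⟩
      Σ[ m < b ] P (b ℕ.* c) ((+ k * + b) %ℕ c ℕ.+ m ℕ.* c)      ≡⟨ Σ<-P b c (b ℕ.* c) ((+ k * + b) %ℕ c) refl ⟩
      + b * Pmod c (+ k * + b)                                   ∎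
      where
      swap : ∀ (j c x : ℤ) → j * - c + x ≡ x - j * c
      swap = solve-∀

    Σₖ-py : ∀ j → Σ[ k < c ] py j k ≡ + c * Pmod b (+ j * - + c)
    Σₖ-py j = trans (Σ<-split⁺ c b (b ℕ.* c) (ℕP.*-comm b c) (+ j * - + c) (P (b ℕ.* c)))
                    (Σ<-P c b (b ℕ.* c) ((+ j * - + c) %ℕ b) (ℕP.*-comm b c))

    Σᵢ-pw : ∀ k → Σ[ i < a ] pw i k ≡ + a * Pmod c (+ k * + a)
    Σᵢ-pw k = begin
      Σ[ i < a ] pw i k                                          ≡⟨ Σ<-cong a (λ i _ → cong (Pmod (a ℕ.* c)) (+-comm (+ i * + c) _)) ⟩
      Σ[ i < a ] Pmod (a ℕ.* c) (+ k * + a + + i * + c)          ≡⟨ Σ<-split⁺ a c (a ℕ.* c) refl (+ k * + a) (P (a ℕ.* c)) ⟩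
      Σ[ m < a ] P (a ℕ.* c) ((+ k * + a) %ℕ c ℕ.+ m ℕ.* c)      ≡⟨ Σ<-P a c (a ℕ.* c) ((+ k * + a) %ℕ c) refl ⟩
      + a * Pmod c (+ k * + a)                                   ∎

    Σₖ-pw : ∀ i → Σ[ k < c ] pw i k ≡ + c * Pmod a (+ i * + c)
    Σₖ-pw i = trans (Σ<-split⁺ c a (a ℕ.* c) (ℕP.*-comm a c) (+ i * + c) (P (a ℕ.* c)))
                    (Σ<-P c a (a ℕ.* c) ((+ i * + c) %ℕ a) (ℕP.*-comm a c))

    E-box : ℕ → ℕ → ℕ → ℤ
    E-box i j k = + c * px i j + + a * py j k - + b * pw i k

    E-box²≡T² : ∀ i j k → E-box i j k * E-box i j k ≡ T * T
    E-box²≡T² i j k = E²≡T² (+ i * + b + + j * + a) (+ j * - + c + + k * + b) (+ i * + c + + k * + a)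
                      (balanced (+ a) (+ b) (+ c) (+ i) (+ j) (+ k))
      where
      balanced : ∀ a b c i j k → c * (i * b + j * a) + a * (j * - c + k * b) ≡ b * (i * c + k * a)
      balanced = solve-∀

    ΣX² ΣY² ΣW² D₁ D₂ D₃ : ℤ
    ΣX² = Σ[ i < a ] Σ[ j < b ] (px i j * px i j)
    ΣY² = Σ[ j < b ] Σ[ k < c ] (py j k * py j k)
    ΣW² = Σ[ i < a ] Σ[ k < c ] (pw i k * pw i k)
    D₁ = Σ[ j < b ] (Pmod b (+ j * + a) * Pmod b (+ j * - + c))
    D₂ = Σ[ i < a ] (Pmod a (+ i * + b) * Pmod a (+ i * + c))
    D₃ = Σ[ k < c ] (Pmod c (+ k * + b) * Pmod c (+ k * + a))

    Σ³-px² : Σ³ (λ i j k → px i j * px i j) ≡ + c * ΣX²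
    Σ³-px² = Σ³-ij (λ i j → px i j * px i j)

    Σ³-py² : Σ³ (λ i j k → py j k * py j k) ≡ + a * ΣY²
    Σ³-py² = Σ³-jk (λ j k → py j k * py j k)

    Σ³-pw² : Σ³ (λ i j k → pw i k * pw i k) ≡ + b * ΣW²
    Σ³-pw² = Σ³-ik (λ i k → pw i k * pw i k)

    Σ³-px·py : Σ³ (λ i j k → px i j * py j k) ≡ + a * + c * D₁
    Σ³-px·py = trans (Σ³-ij·jk px py) (Σ<-scaled-* b (+ a) (+ c) Σᵢ-px Σₖ-py)

    Σ³-px·pw : Σ³ (λ i j k → px i j * pw i k) ≡ + b * + c * D₂
    Σ³-px·pw = trans (Σ³-ij·ik px pw) (Σ<-scaled-* a (+ b) (+ c) Σⱼ-px Σₖ-pw)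

    Σ³-py·pw : Σ³ (λ i j k → py j k * pw i k) ≡ + b * + a * D₃
    Σ³-py·pw = trans (Σ³-jk·ik py pw) (Σ<-scaled-* c (+ b) (+ a) Σⱼ-py Σᵢ-pw)

    Σ³-const : ∀ x → Σ³ (λ _ _ _ → x) ≡ + c * (+ a * (+ b * x))
    Σ³-const x = trans (Σ³-ij (λ _ _ → x)) (cong (+ c *_) (trans (Σ<-cong a (λ i _ → Σ<-const b x)) (Σ<-const a _)))

    Σ³-E-box²-expansion : Σ³ (λ i j k → E-box i j k * E-box i j k)
                       ≡ + c * + c * (+ c * ΣX²) + + a * + a * (+ a * ΣY²) + + b * + b * (+ b * ΣW²)
                         + + 2 * + a * + c * (+ a * + c * D₁) + - (+ 2 * + b * + c) * (+ b * + c * D₂)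
                         + - (+ 2 * + a * + b) * (+ b * + a * D₃)
    Σ³-E-box²-expansion = begin
      Σ³ (λ i j k → E-box i j k * E-box i j k)
        ≡⟨ Σ³-cong (λ i j k → square (+ a) (+ b) (+ c) (px i j) (py j k) (pw i k)) ⟩
      Σ³ (λ i j k → u₁ * f₁ i j k + u₂ * f₂ i j k + u₃ * f₃ i j k + u₄ * f₄ i j k + u₅ * f₅ i j k + u₆ * f₆ i j k)
        ≡⟨ trans (Σ³-+*ˡ _ u₆ f₆) (cong (_+ u₆ * Σ³ f₆)
           (trans (Σ³-+*ˡ _ u₅ f₅) (cong (_+ u₅ * Σ³ f₅)
           (trans (Σ³-+*ˡ _ u₄ f₄) (cong (_+ u₄ * Σ³ f₄)
           (trans (Σ³-+*ˡ _ u₃ f₃) (cong (_+ u₃ * Σ³ f₃)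
           (trans (Σ³-+*ˡ _ u₂ f₂) (cong (_+ u₂ * Σ³ f₂)
           (Σ³-*ˡ u₁ f₁)))))))))) ⟩
      u₁ * Σ³ f₁ + u₂ * Σ³ f₂ + u₃ * Σ³ f₃ + u₄ * Σ³ f₄ + u₅ * Σ³ f₅ + u₆ * Σ³ f₆
        ≡⟨ cong₂ _+_ (cong₂ _+_ (cong₂ _+_ (cong₂ _+_ (cong₂ _+_
             (cong (u₁ *_) Σ³-px²) (cong (u₂ *_) Σ³-py²)) (cong (u₃ *_) Σ³-pw²))
             (cong (u₄ *_) Σ³-px·py)) (cong (u₅ *_) Σ³-px·pw)) (cong (u₆ *_) Σ³-py·pw) ⟩
      u₁ * (+ c * ΣX²) + u₂ * (+ a * ΣY²) + u₃ * (+ b * ΣW²)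
        + u₄ * (+ a * + c * D₁) + u₅ * (+ b * + c * D₂) + u₆ * (+ b * + a * D₃) ∎
      where
      Σ³-+*ˡ : ∀ F (u : ℤ) G → Σ³ (λ i j k → F i j k + u * G i j k) ≡ Σ³ F + u * Σ³ G
      Σ³-+*ˡ F u G = trans (Σ³-+ F _) (cong (_+_ (Σ³ F)) (Σ³-*ˡ u G))
      u₁ u₂ u₃ u₄ u₅ u₆ : ℤ
      u₁ = + c * + c
      u₂ = + a * + a
      u₃ = + b * + b
      u₄ = + 2 * + a * + c
      u₅ = - (+ 2 * + b * + c)
      u₆ = - (+ 2 * + a * + b)
      f₁ f₂ f₃ f₄ f₅ f₆ : ℕ → ℕ → ℕ → ℤ
      f₁ i j k = px i j * px i j
      f₂ i j k = py j k * py j k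
      f₃ i j k = pw i k * pw i k
      f₄ i j k = px i j * py j k
      f₅ i j k = px i j * pw i k
      f₆ i j k = py j k * pw i k
      square : ∀ a b c x y w → (c * x + a * y - b * w) * (c * x + a * y - b * w)
               ≡ c * c * (x * x) + a * a * (y * y) + b * b * (w * w)
                 + + 2 * a * c * (x * y) + - (+ 2 * b * c) * (x * w) + - (+ 2 * a * b) * (y * w)
      square = solve-∀

    box-identity : + c * + c * (+ c * ΣX²) + + a * + a * (+ a * ΣY²) + + b * + b * (+ b * ΣW²)
                + + 2 * + a * + c * (+ a * + c * D₁) + - (+ 2 * + b * + c) * (+ b * + c * D₂)
                + - (+ 2 * + a * + b) * (+ b * + a * D₃)
                ≡ + c * (+ a * (+ b * (T * T)))
    box-identity = trans (sym Σ³-E-box²-expansion) (trans (Σ³-cong E-box²≡T²) (Σ³-const (T * T)))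

    ΣX²-eval : ∀ {a′} → InverseMod b a′ (+ a) → + 3 * ΣX² ≡ + a * + b * (+ a * + b * (+ a * + b) + + 2)
    ΣX²-eval a′a≡1 = trans (cong (+ 3 *_) (Σ<-comm a b _)) (Σ<-grid-P² a b a′a≡1 px column)
      where
      column : ∀ j → + 3 * Σ[ i < a ] (px i j * px i j)
                     ≡ + 3 * + a * (Pmod b (+ j * + a) * Pmod b (+ j * + a)) + + a * (+ b * + b) * (+ a * + a - 1ℤ)
      column j = trans (cong (+ 3 *_) (trans (Σ<-cong a (λ i _ → cong (λ z → Pmod (a ℕ.* b) z * Pmod (a ℕ.* b) z) (+-comm (+ i * + b) _)))
                                             (Σ<-split⁺ a b (a ℕ.* b) refl (+ j * + a) (λ r → P (a ℕ.* b) r * P (a ℕ.* b) r))))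
                       (Σ<-P² a b (a ℕ.* b) ((+ j * + a) %ℕ b) refl)

    ΣY²-eval : ∀ {b′} → InverseMod c b′ (+ b) → + 3 * ΣY² ≡ + b * + c * (+ b * + c * (+ b * + c) + + 2)
    ΣY²-eval b′b≡1 = trans (cong (+ 3 *_) (Σ<-comm b c _)) (Σ<-grid-P² b c b′b≡1 (λ j k → py j k) column)
      where
      swap : ∀ (j c x : ℤ) → j * - c + x ≡ x - j * c
      swap = solve-∀
      column : ∀ k → + 3 * Σ[ j < b ] (py j k * py j k)
                     ≡ + 3 * + b * (Pmod c (+ k * + b) * Pmod c (+ k * + b)) + + b * (+ c * + c) * (+ b * + b - 1ℤ)
      column k = trans (cong (+ 3 *_) (trans (Σ<-cong b (λ j _ → cong (λ z → Pmod (b ℕ.* c) z * Pmod (b ℕ.* c) z) (swap (+ j) (+ c) (+ k * + b))))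
                                             (Σ<-split⁻ b c (b ℕ.* c) refl (+ k * + b) (λ r → P (b ℕ.* c) r * P (b ℕ.* c) r))))
                       (Σ<-P² b c (b ℕ.* c) ((+ k * + b) %ℕ c) refl)

    ΣW²-eval : ∀ {a″} → InverseMod c a″ (+ a) → + 3 * ΣW² ≡ + a * + c * (+ a * + c * (+ a * + c) + + 2)
    ΣW²-eval a″a≡1 = trans (cong (+ 3 *_) (Σ<-comm a c _)) (Σ<-grid-P² a c a″a≡1 pw column)
      where
      column : ∀ k → + 3 * Σ[ i < a ] (pw i k * pw i k)
                     ≡ + 3 * + a * (Pmod c (+ k * + a) * Pmod c (+ k * + a)) + + a * (+ c * + c) * (+ a * + a - 1ℤ)
      column k = trans (cong (+ 3 *_) (trans (Σ<-cong a (λ i _ → cong (λ z → Pmod (a ℕ.* c) z * Pmod (a ℕ.* c) z) (+-comm (+ i * + c) _)))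
                                             (Σ<-split⁺ a c (a ℕ.* c) refl (+ k * + a) (λ r → P (a ℕ.* c) r * P (a ℕ.* c) r))))
                       (Σ<-P² a c (a ℕ.* c) ((+ k * + a) %ℕ c) refl)

    three-term : ∀ {a′ b′ a″} → InverseMod b a′ (+ a) → InverseMod c b′ (+ b) → InverseMod c a″ (+ a) →
                 + 3 * (+ a * + a) * (+ c * + c) * D₁ - + 3 * (+ b * + b) * (+ c * + c) * D₂ - + 3 * (+ a * + a) * (+ b * + b) * D₃
                   ≡ - (T * (+ a * + a + + b * + b + + c * + c))
    three-term a′a≡1 b′b≡1 a″a≡1 =
      *-cancelˡ-≡ (+ 2) _ _ (i-j≡0⇒i≡j _ _ (trans (certificate (+ a) (+ b) (+ c) ΣX² ΣY² ΣW² D₁ D₂ D₃)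
        (vanish (+ a) (+ b) (+ c) (i≡j⇒i-j≡0 box-identity) (i≡j⇒i-j≡0 (ΣX²-eval a′a≡1))
                                  (i≡j⇒i-j≡0 (ΣY²-eval b′b≡1)) (i≡j⇒i-j≡0 (ΣW²-eval a″a≡1)))))
      where
      vanish : ∀ (a b c : ℤ) {p q r s} → p ≡ 0ℤ → q ≡ 0ℤ → r ≡ 0ℤ → s ≡ 0ℤ →
               + 3 * p - c * c * c * q - a * a * a * r - b * b * b * s ≡ 0ℤ
      vanish a b c refl refl refl refl = solve (a ∷ b ∷ c ∷ [])
      -- Twice the difference of the two sides, as a combination of the four identities used.
      certificate : ∀ a b c X Y W D₁ D₂ D₃ →
        + 2 * (+ 3 * (a * a) * (c * c) * D₁ - + 3 * (b * b) * (c * c) * D₂ - + 3 * (a * a) * (b * b) * D₃)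
          - + 2 * (- (a * b * c * (a * a + b * b + c * c)))
        ≡ + 3 * (c * c * (c * X) + a * a * (a * Y) + b * b * (b * W)
                 + + 2 * a * c * (a * c * D₁) + - (+ 2 * b * c) * (b * c * D₂) + - (+ 2 * a * b) * (b * a * D₃)
                 - c * (a * (b * (a * b * c * (a * b * c)))))
          - c * c * c * (+ 3 * X - a * b * (a * b * (a * b) + + 2))
          - a * a * a * (+ 3 * Y - b * c * (b * c * (b * c) + + 2))
          - b * b * b * (+ 3 * W - a * c * (a * c * (a * c) + + 2))
      certificate = solve-∀

    D₁-eval : ∀ {a′ c′} → InverseMod b (+ a) a′ → InverseMod b (- + c) c′ → D₁ ≡ + b * + b + dedekindℤ (a′ * - + c) b
    D₁-eval = Σ<-Pmod-Pmod b

    D₂-eval : ∀ {b′ c′} → InverseMod a (+ b) b′ → InverseMod a (+ c) c′ → D₂ ≡ + a * + a + dedekindℤ (b′ * + c) a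
    D₂-eval = Σ<-Pmod-Pmod a

    D₃-eval : ∀ {a′ b′} → InverseMod c (+ a) a′ → InverseMod c (+ b) b′ → D₃ ≡ + c * + c + dedekindℤ (a′ * + b) c
    D₃-eval aa′≡1 bb′≡1 = trans (Σ<-cong c (λ k _ → *-comm (Pmod c (+ k * + b)) _)) (Σ<-Pmod-Pmod c aa′≡1 bb′≡1)

  reciprocityℤ : ∀ a b t {{_ : NonZero a}} {{_ : NonZero b}} {{_ : NonZero t}} {a* b*} →
                 InverseMod b (+ a) a* → InverseMod a (+ b) b* → t ℕ∣.∣ a ℕ.* a ℕ.+ 1 → gcd b t ≡ 1 →
                 + 3 * (+ a * + a) * (+ t * + t) * dedekindℤ (+ t * a*) b
                   + + 3 * (+ b * + b) * (+ t * + t) * dedekindℤ (+ t * b*) a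
                 ≡ + a * + b * + t * (+ a * + a + + b * + b + + t * + t - + 3 * (+ a * + b * + t))
                   + + 3 * (+ a * + a) * (+ b * + b) * dedekindℤ (+ (a ℕ.* b)) t
  reciprocityℤ a b t {a*} {b*} aa*≡1 bb*≡1 t∣a²+1 gcd[b,t]≡1 =
    i-j≡0⇒i≡j _ _ (trans (certificate (+ a) (+ b) (+ t) s₁ s₂ s₃) (cong -_ (i≡j⇒i-j≡0 relation)))
    where
    open Box a b t
    s₁ s₂ s₃ : ℤ
    s₁ = dedekindℤ (+ t * a*) b
    s₂ = dedekindℤ (+ t * b*) a
    s₃ = dedekindℤ (+ (a ℕ.* b)) t
    b′ t′ : ℤ
    b′ = proj₁ (coprime⇒inverseMod b t gcd[b,t]≡1)
    t′ = proj₁ (coprime⇒inverseMod t b (trans (gcd-comm t b) gcd[b,t]≡1))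
    b-unit : InverseMod t (+ b) b′
    b-unit = proj₂ (coprime⇒inverseMod b t gcd[b,t]≡1)
    t-unit-mod-b : InverseMod b (+ t) t′
    t-unit-mod-b = proj₂ (coprime⇒inverseMod t b (trans (gcd-comm t b) gcd[b,t]≡1))
    a*[-t]≡-[ta*] : a* * - + t ≡ - (+ t * a*)
    a*[-t]≡-[ta*] = trans (sym (neg-distribʳ-* a* (+ t))) (cong -_ (*-comm a* (+ t)))
    [-a]b≡-[ab] : - + a * + b ≡ - + (a ℕ.* b)
    [-a]b≡-[ab] = trans (sym (neg-distribˡ-* (+ a) (+ b))) (cong -_ (sym (pos-* a b)))
    D₁≡ : D₁ ≡ + b * + b - s₁
    D₁≡ = trans (D₁-eval aa*≡1 (inverseMod-neg t-unit-mod-b))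
                (cong (_+_ (+ b * + b)) (trans (cong (λ h → dedekindℤ h b) a*[-t]≡-[ta*]) (dedekindℤ-neg (+ t * a*) b)))
    D₂≡ : D₂ ≡ + a * + a + s₂
    D₂≡ = trans (D₂-eval bb*≡1 (proj₂ (∣m²+1⇒inverseMod t∣a²+1)))
                (cong (λ h → + a * + a + dedekindℤ h a) (*-comm b* (+ t)))
    D₃≡ : D₃ ≡ + t * + t - s₃
    D₃≡ = trans (D₃-eval (∣m²+1⇒inverseMod-neg t∣a²+1) b-unit)
                (cong (_+_ (+ t * + t)) (trans (cong (λ h → dedekindℤ h t) [-a]b≡-[ab]) (dedekindℤ-neg (+ (a ℕ.* b)) t)))
    relation : + 3 * (+ a * + a) * (+ t * + t) * (+ b * + b - s₁) - + 3 * (+ b * + b) * (+ t * + t) * (+ a * + a + s₂)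
               - + 3 * (+ a * + a) * (+ b * + b) * (+ t * + t - s₃) ≡ - (T * (+ a * + a + + b * + b + + t * + t))
    relation = trans (sym (cong₂ _-_ (cong₂ _-_ (cong (+ 3 * (+ a * + a) * (+ t * + t) *_) D₁≡)
                                                (cong (+ 3 * (+ b * + b) * (+ t * + t) *_) D₂≡))
                                     (cong (+ 3 * (+ a * + a) * (+ b * + b) *_) D₃≡)))
                     (three-term (inverseMod-comm aa*≡1) (inverseMod-comm b-unit) (inverseMod-comm (∣m²+1⇒inverseMod-neg t∣a²+1)))
    certificate : ∀ a b t s₁ s₂ s₃ →
      + 3 * (a * a) * (t * t) * s₁ + + 3 * (b * b) * (t * t) * s₂
        - (a * b * t * (a * a + b * b + t * t - + 3 * (a * b * t)) + + 3 * (a * a) * (b * b) * s₃)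
      ≡ - (+ 3 * (a * a) * (t * t) * (b * b - s₁) - + 3 * (b * b) * (t * t) * (a * a + s₂)
           - + 3 * (a * a) * (b * b) * (t * t - s₃) - - (a * b * t * (a * a + b * b + t * t)))
    certificate = solve-∀

module Sawtooth where

  open import Defs
  open Reciprocity using (Σ<; Σ<-shift; P; P₀; P₀mod; dedekindℤ; divMod-unique; %ℕ-unique; r<d⇒r%ℕd≡r)
  open import Data.Nat as ℕ using (ℕ; zero; suc; NonZero)
  import Data.Nat.Properties as ℕP
  import Data.Nat.Divisibility as ℕ∣
  import Data.Nat.GCD as ℕGCD
  open import Data.Integer as ℤ using (ℤ; +_; -[1+_]; _%ℕ_; _/ℕ_)
  import Data.Integer.Properties as ℤP
  import Data.Integer.GCD as ℤGCD
  open import Data.Integer.DivMod using (a≡a%ℕn+[a/ℕn]*n; n%ℕd<d; div-pos-is-/ℕ)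
  open import Data.Integer.Tactic.RingSolver
  open import Data.Rational using (ℚ; mkℚ; _/_; _+_; _-_; _*_; -_; 0ℚ; ½; floor; ↥_; ↧_; ↧ₙ_; toℚᵘ)
  open import Data.Rational.Properties
    using (↥-/; ↧-/; 0/n≡0; toℚᵘ-injective; toℚᵘ-fromℚᵘ; toℚᵘ-homo-+; toℚᵘ-homo-*; toℚᵘ-homo‿-; fromℚᵘ-cong)
  import Data.Rational.Unnormalised as ℚᵘ
  import Data.Rational.Unnormalised.Properties as ℚᵘP
  open import Data.List using (_∷_; [])
  open import Data.Empty using (⊥-elim)
  open import Data.Product using (Σ; _,_; proj₁; proj₂; _×_)
  open import Relation.Nullary using (¬_)
  open import Relation.Binary.PropositionalEquality
  open ≡-Reasoning

  -- Fraction arithmetic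

  /-cross : ∀ (m n : ℤ) (d e : ℕ) .{{_ : NonZero d}} .{{_ : NonZero e}} → m ℤ.* + e ≡ n ℤ.* + d → m / d ≡ n / e
  /-cross m n (suc d) (suc e) eq = fromℚᵘ-cong {ℚᵘ.mkℚᵘ m d} {ℚᵘ.mkℚᵘ n e} (ℚᵘ.*≡* eq)

  toℚᵘ-/ : ∀ (m : ℤ) (d : ℕ) .{{_ : NonZero d}} → toℚᵘ (m / d) ℚᵘ.≃ (m ℚᵘ./ d)
  toℚᵘ-/ m (suc d) = toℚᵘ-fromℚᵘ (ℚᵘ.mkℚᵘ m d)

  /+/≡/ : ∀ (m n k : ℤ) (d e f : ℕ) .{{_ : NonZero f}} .{{_ : NonZero d}} .{{_ : NonZero e}} →
          (m ℤ.* + e ℤ.+ n ℤ.* + d) ℤ.* + f ≡ k ℤ.* (+ d ℤ.* + e) → m / d + n / e ≡ k / f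
  /+/≡/ m n k d@(suc _) e@(suc _) f eq =
    trans (toℚᵘ-injective (ℚᵘP.≃-trans (toℚᵘ-homo-+ (m / d) (n / e))
            (ℚᵘP.≃-trans (ℚᵘP.+-cong (toℚᵘ-/ m d) (toℚᵘ-/ n e)) (ℚᵘP.≃-sym (toℚᵘ-/ (m ℤ.* + e ℤ.+ n ℤ.* + d) (d ℕ.* e))))))
          (/-cross (m ℤ.* + e ℤ.+ n ℤ.* + d) k (d ℕ.* e) f (trans eq (cong (k ℤ.*_) (sym (ℤP.pos-* d e)))))

  /*/≡/ : ∀ (m n k : ℤ) (d e f : ℕ) .{{_ : NonZero f}} .{{_ : NonZero d}} .{{_ : NonZero e}} →
          m ℤ.* n ℤ.* + f ≡ k ℤ.* (+ d ℤ.* + e) → (m / d) * (n / e) ≡ k / f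
  /*/≡/ m n k d@(suc _) e@(suc _) f eq =
    trans (toℚᵘ-injective (ℚᵘP.≃-trans (toℚᵘ-homo-* (m / d) (n / e))
            (ℚᵘP.≃-trans (ℚᵘP.*-cong (toℚᵘ-/ m d) (toℚᵘ-/ n e)) (ℚᵘP.≃-sym (toℚᵘ-/ (m ℤ.* n) (d ℕ.* e))))))
          (/-cross (m ℤ.* n) k (d ℕ.* e) f (trans eq (cong (k ℤ.*_) (sym (ℤP.pos-* d e)))))

  -‿/ : ∀ (n : ℤ) (d : ℕ) .{{_ : NonZero d}} → - (n / d) ≡ (ℤ.- n) / d
  -‿/ n (suc d) = toℚᵘ-injective (ℚᵘP.≃-trans (toℚᵘ-homo‿- (n / suc d))
    (ℚᵘP.≃-trans (ℚᵘP.-‿cong (toℚᵘ-/ n (suc d))) (ℚᵘP.≃-sym (toℚᵘ-/ _ (suc d)))))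

  ↥-/-cross : ∀ (n : ℤ) d .{{_ : NonZero d}} → ↥ (n / d) ℤ.* + d ≡ n ℤ.* ↧ (n / d)
  ↥-/-cross n d = begin
    ↥ x ℤ.* + d              ≡⟨ cong (↥ x ℤ.*_) (sym (↧-/ n d)) ⟩
    ↥ x ℤ.* (↧ x ℤ.* g)      ≡⟨ regroup (↥ x) (↧ x) g ⟩
    (↥ x ℤ.* g) ℤ.* ↧ x      ≡⟨ cong (ℤ._* ↧ x) (↥-/ n d) ⟩
    n ℤ.* ↧ x                ∎
    where
    x = n / d
    g = ℤGCD.gcd n (+ d)
    regroup : ∀ (u v w : ℤ) → u ℤ.* (v ℤ.* w) ≡ (u ℤ.* w) ℤ.* v
    regroup = solve-∀

  scaled-residue : ∀ (R : ℤ) d D {r} .{{_ : NonZero d}} .{{_ : NonZero D}} → r ℕ.< d → R ℤ.* + d ≡ + r ℤ.* + D →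
                   Σ ℕ (λ r′ → R ≡ + r′ × r′ ℕ.< D)
  scaled-residue (+ r′) d D {r} r<d r′d≡rD = r′ , refl , ℕP.≰⇒> D≰r′
    where
    r′d≡rD′ : r′ ℕ.* d ≡ r ℕ.* D
    r′d≡rD′ = ℤP.+-injective (trans (ℤP.pos-* r′ d) (trans r′d≡rD (sym (ℤP.pos-* r D))))
    D≰r′ : ¬ (D ℕ.≤ r′)
    D≰r′ D≤r′ = ℕP.<⇒≱ (ℕP.*-monoˡ-< D r<d)
      (ℕP.≤-trans (ℕP.≤-reflexive (ℕP.*-comm d D)) (ℕP.≤-trans (ℕP.*-monoˡ-≤ d D≤r′) (ℕP.≤-reflexive r′d≡rD′)))
  scaled-residue -[1+ k ] (suc d) D {r} r<d eq with trans eq (sym (ℤP.pos-* r D))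
  ... | ()

  floor-eta : ∀ p → floor p ≡ ↥ p ℤ./ ↧ p
  floor-eta (mkℚ n d c) = refl

  floor-/ : ∀ (n : ℤ) d .{{_ : NonZero d}} → floor (n / d) ≡ n /ℕ d
  floor-/ n d = begin
    floor x              ≡⟨ floor-eta x ⟩
    ↥ x ℤ./ ↧ x          ≡⟨ div-pos-is-/ℕ (↥ x) (↧ₙ x) ⟩
    ↥ x /ℕ ↧ₙ x          ≡⟨ proj₂ (divMod-unique (↥ x) (↧ₙ x) r′ q (proj₂ (proj₂ R≡r′)) ↥x≡) ⟩
    q                    ∎
    where
    x = n / d
    q = n /ℕ d
    R = ↥ x ℤ.- q ℤ.* ↧ x
    shift : ∀ (X Q D N e r : ℤ) → X ℤ.* e ≡ N ℤ.* D → N ≡ r ℤ.+ Q ℤ.* e → (X ℤ.- Q ℤ.* D) ℤ.* e ≡ r ℤ.* D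
    shift X Q D N e r Xe≡ND refl = begin
      (X ℤ.- Q ℤ.* D) ℤ.* e             ≡⟨ solve (X ∷ Q ∷ D ∷ e ∷ []) ⟩
      X ℤ.* e ℤ.- Q ℤ.* D ℤ.* e         ≡⟨ cong (ℤ._- Q ℤ.* D ℤ.* e) Xe≡ND ⟩
      (r ℤ.+ Q ℤ.* e) ℤ.* D ℤ.- Q ℤ.* D ℤ.* e   ≡⟨ solve (r ∷ Q ∷ D ∷ e ∷ []) ⟩
      r ℤ.* D                           ∎
    R≡r′ : Σ ℕ (λ r′ → R ≡ + r′ × r′ ℕ.< ↧ₙ x)
    R≡r′ = scaled-residue R d (↧ₙ x) (n%ℕd<d n d) (shift (↥ x) q (↧ x) n (+ d) (+ (n %ℕ d)) (↥-/-cross n d) (a≡a%ℕn+[a/ℕn]*n n d))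
    r′ = proj₁ R≡r′
    unshift : ∀ (X Q D R : ℤ) → X ℤ.- Q ℤ.* D ≡ R → X ≡ R ℤ.+ Q ℤ.* D
    unshift X Q D R refl = solve (X ∷ Q ∷ D ∷ [])
    ↥x≡ : ↥ x ≡ + r′ ℤ.+ q ℤ.* + ↧ₙ x
    ↥x≡ = unshift (↥ x) q (↧ x) (+ r′) (proj₁ (proj₂ R≡r′))

  ↧ₙ-/≡1 : ∀ (n : ℤ) d .{{_ : NonZero d}} → n %ℕ d ≡ 0 → ↧ₙ (n / d) ≡ 1
  ↧ₙ-/≡1 n d n%d≡0 = ℤP.+-injective (ℤP.*-cancelʳ-≡ (↧ (n / d)) (+ 1) (+ d) (begin
    ↧ (n / d) ℤ.* + d                     ≡⟨ cong (λ g → ↧ (n / d) ℤ.* + g) (sym gcd≡d) ⟩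
    ↧ (n / d) ℤ.* ℤGCD.gcd n (+ d)        ≡⟨ ↧-/ n d ⟩
    + d                                   ≡⟨ sym (ℤP.*-identityˡ (+ d)) ⟩
    + 1 ℤ.* + d                           ∎))
    where
    n≡qd : n ≡ n /ℕ d ℤ.* + d
    n≡qd = trans (a≡a%ℕn+[a/ℕn]*n n d) (trans (cong (λ r → + r ℤ.+ n /ℕ d ℤ.* + d) n%d≡0) (ℤP.+-identityˡ _))
    d∣n : d ℕ∣.∣ ℤ.∣ n ∣
    d∣n = ℕ∣.divides ℤ.∣ n /ℕ d ∣ (trans (cong ℤ.∣_∣ n≡qd) (ℤP.abs-* (n /ℕ d) (+ d)))
    gcd≡d : ℕGCD.gcd ℤ.∣ n ∣ d ≡ d
    gcd≡d = ℕ∣.∣-antisym (ℕGCD.gcd[m,n]∣n ℤ.∣ n ∣ d) (ℕGCD.gcd-greatest d∣n ℕ∣.∣-refl)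

  ↧ₙ-/≢1 : ∀ (n : ℤ) d .{{_ : NonZero d}} → n %ℕ d ≢ 0 → ↧ₙ (n / d) ≢ 1
  ↧ₙ-/≢1 n d n%d≢0 ↧≡1 = n%d≢0 (%ℕ-unique n d 0 (↥ (n / d)) (ℕ.>-nonZero⁻¹ d) (begin
    n                            ≡⟨ sym (ℤP.*-identityʳ n) ⟩
    n ℤ.* + 1                    ≡⟨ cong (λ D → n ℤ.* + D) (sym ↧≡1) ⟩
    n ℤ.* ↧ (n / d)              ≡⟨ sym (↥-/-cross n d) ⟩
    ↥ (n / d) ℤ.* + d            ≡⟨ sym (ℤP.+-identityˡ _) ⟩
    + 0 ℤ.+ ↥ (n / d) ℤ.* + d    ∎))

  -- The sawtooth function at n / d

  saw-integer : ∀ x → ↧ₙ x ≡ 1 → saw x ≡ 0ℚ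
  saw-integer (mkℚ n zero c) _ = refl

  saw-fraction : ∀ x → ↧ₙ x ≢ 1 → saw x ≡ (x - floor x / 1) - ½
  saw-fraction (mkℚ n zero    c) ↧≢1 = ⊥-elim (↧≢1 refl)
  saw-fraction (mkℚ n (suc k) c) _   = refl

  2d≢0 : ∀ d .{{_ : NonZero d}} → NonZero (2 ℕ.* d)
  2d≢0 d = ℕP.m*n≢0 2 d

  saw-/ : ∀ (n : ℤ) d .{{_ : NonZero d}} → saw (n / d) ≡ (P₀mod d n / (2 ℕ.* d)) {{2d≢0 d}}
  saw-/ n d with n %ℕ d in n%d≡
  ... | zero  = trans (saw-integer (n / d) (↧ₙ-/≡1 n d n%d≡)) (sym (0/n≡0 (2 ℕ.* d) {{2d≢0 d}}))
  ... | suc r = begin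
    saw (n / d)                                  ≡⟨ saw-fraction (n / d) (↧ₙ-/≢1 n d (λ n%d≡0 → 0≢1+r (trans (sym n%d≡0) n%d≡))) ⟩
    (n / d - floor (n / d) / 1) - ½              ≡⟨ cong (λ z → (n / d - z / 1) - ½) (floor-/ n d) ⟩
    (n / d + - (q / 1)) + - (+ 1 / 2)            ≡⟨ cong₂ (λ u v → (n / d + u) + v) (-‿/ q 1) (-‿/ (+ 1) 2) ⟩
    (n / d + (ℤ.- q) / 1) + (ℤ.- + 1) / 2        ≡⟨ cong (_+ (ℤ.- + 1) / 2) (/+/≡/ n (ℤ.- q) (+ suc r) d 1 d residue) ⟩
    + suc r / d + (ℤ.- + 1) / 2                  ≡⟨ /+/≡/ (+ suc r) (ℤ.- + 1) (P d (suc r)) d 2 (2 ℕ.* d) {{2d≢0 d}} centre ⟩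
    (P d (suc r) / (2 ℕ.* d)) {{2d≢0 d}}         ∎
    where
    q = n /ℕ d
    0≢1+r : 0 ≢ suc r
    0≢1+r ()
    n≡ : n ≡ + suc r ℤ.+ q ℤ.* + d
    n≡ = trans (a≡a%ℕn+[a/ℕn]*n n d) (cong (λ z → + z ℤ.+ q ℤ.* + d) n%d≡)
    subtract : ∀ (n r q d : ℤ) → n ≡ r ℤ.+ q ℤ.* d → (n ℤ.* + 1 ℤ.+ ℤ.- q ℤ.* d) ℤ.* d ≡ r ℤ.* (d ℤ.* + 1)
    subtract _ r q d refl = solve (r ∷ q ∷ d ∷ [])
    residue : (n ℤ.* + 1 ℤ.+ ℤ.- q ℤ.* + d) ℤ.* + d ≡ + suc r ℤ.* (+ d ℤ.* + 1)
    residue = subtract n (+ suc r) q (+ d) n≡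
    halve : ∀ (r d d₂ : ℤ) → d₂ ≡ + 2 ℤ.* d → (r ℤ.* + 2 ℤ.+ ℤ.- + 1 ℤ.* d) ℤ.* d₂ ≡ (+ 2 ℤ.* r ℤ.- d) ℤ.* (d ℤ.* + 2)
    halve r d _ refl = solve (r ∷ d ∷ [])
    centre : (+ suc r ℤ.* + 2 ℤ.+ ℤ.- + 1 ℤ.* + d) ℤ.* + (2 ℕ.* d) ≡ P d (suc r) ℤ.* (+ d ℤ.* + 2)
    centre = halve (+ suc r) (+ d) _ (ℤP.pos-* 2 d)

  -- Dedekind sums as fractions

  tab≢0 : ∀ {t a b} .{{_ : NonZero t}} .{{_ : NonZero a}} .{{_ : NonZero b}} → NonZero (t ℕ.* a ℕ.* b)
  tab≢0 {t} {a} {b} = ℕP.m*n≢0 (t ℕ.* a) b {{ℕP.m*n≢0 t a}}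

  4d²≢0 : ∀ d .{{_ : NonZero d}} → NonZero (2 ℕ.* d ℕ.* (2 ℕ.* d))
  4d²≢0 d = ℕP.m*n≢0 (2 ℕ.* d) (2 ℕ.* d) {{2d≢0 d}} {{2d≢0 d}}

  sum1-/ : ∀ n (F : ℕ → ℚ) (G : ℕ → ℤ) D .{{_ : NonZero D}} → (∀ k → F (suc k) ≡ G k / D) → sum1 n F ≡ Σ< n G / D
  sum1-/ zero    F G D F≡G/D = sym (0/n≡0 D)
  sum1-/ (suc n) F G D F≡G/D = begin
    sum1 n F + F (suc n)          ≡⟨ cong₂ _+_ (sum1-/ n F G D F≡G/D) (F≡G/D n) ⟩
    Σ< n G / D + G n / D          ≡⟨ /+/≡/ (Σ< n G) (G n) (Σ< n G ℤ.+ G n) D D D (common (Σ< n G) (G n) (+ D)) ⟩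
    (Σ< n G ℤ.+ G n) / D          ∎
    where
    common : ∀ (x y D : ℤ) → (x ℤ.* D ℤ.+ y ℤ.* D) ℤ.* D ≡ (x ℤ.+ y) ℤ.* (D ℤ.* D)
    common = solve-∀

  dedekind-/ : ∀ (h : ℤ) d .{{_ : NonZero d}} → dedekind h d ≡ (dedekindℤ h d / (2 ℕ.* d ℕ.* (2 ℕ.* d))) {{4d²≢0 d}}
  dedekind-/ h d = trans
    (sum1-/ d _ (λ k → g (suc k)) (2 ℕ.* d ℕ.* (2 ℕ.* d)) {{4d²≢0 d}}
      (λ k → trans (cong₂ _*_ (saw-/ (+ suc k) d) (saw-/ (h ℤ.* + suc k) d))
                   (/*/≡/ (P₀mod d (+ suc k)) (P₀mod d (h ℤ.* + suc k)) (g (suc k)) (2 ℕ.* d) (2 ℕ.* d) (2 ℕ.* d ℕ.* (2 ℕ.* d))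
                          {{4d²≢0 d}} {{2d≢0 d}} {{2d≢0 d}} (cong (g (suc k) ℤ.*_) (ℤP.pos-* (2 ℕ.* d) (2 ℕ.* d))))))
    (cong (λ z → (z / (2 ℕ.* d ℕ.* (2 ℕ.* d))) {{4d²≢0 d}}) shift)
    where
    g : ℕ → ℤ
    g k = P₀mod d (+ k) ℤ.* P₀mod d (h ℤ.* + k)
    P₀mod-0 : P₀mod d (+ 0) ≡ + 0
    P₀mod-0 = cong (P₀ d) (r<d⇒r%ℕd≡r d (ℕ.>-nonZero⁻¹ d))
    P₀mod-d : P₀mod d (+ d) ≡ + 0
    P₀mod-d = cong (P₀ d) (%ℕ-unique (+ d) d 0 (+ 1) (ℕ.>-nonZero⁻¹ d) (sym (trans (ℤP.+-identityˡ _) (ℤP.*-identityˡ (+ d)))))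
    g0≡0 : g 0 ≡ + 0
    g0≡0 = trans (cong (ℤ._* P₀mod d (h ℤ.* + 0)) P₀mod-0) (ℤP.*-zeroˡ (P₀mod d (h ℤ.* + 0)))
    gd≡0 : g d ≡ + 0
    gd≡0 = trans (cong (ℤ._* P₀mod d (h ℤ.* + d)) P₀mod-d) (ℤP.*-zeroˡ (P₀mod d (h ℤ.* + d)))
    shift : Σ< d (λ k → g (suc k)) ≡ dedekindℤ h d
    shift = begin
      Σ< d (λ k → g (suc k))            ≡⟨ sym (ℤP.+-identityʳ _) ⟩
      Σ< d (λ k → g (suc k)) ℤ.+ + 0    ≡⟨ cong (ℤ._+_ (Σ< d (λ k → g (suc k)))) (sym g0≡0) ⟩
      Σ< d (λ k → g (suc k)) ℤ.+ g 0    ≡⟨ Σ<-shift d g ⟩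
      Σ< d g ℤ.+ g d                    ≡⟨ cong (ℤ._+_ (Σ< d g)) gd≡0 ⟩
      Σ< d g ℤ.+ + 0                    ≡⟨ ℤP.+-identityʳ _ ⟩
      dedekindℤ h d                     ∎

  S-/ : ∀ (h : ℤ) d .{{_ : NonZero d}} → S h d ≡ ((+ 3 ℤ.* dedekindℤ h d) / (d ℕ.* d)) {{ℕP.m*n≢0 d d}}
  S-/ h d = trans (cong ((+ 12 / 1) *_) (dedekind-/ h d))
                  (/*/≡/ (+ 12) (dedekindℤ h d) (+ 3 ℤ.* dedekindℤ h d) 1 (2 ℕ.* d ℕ.* (2 ℕ.* d)) (d ℕ.* d)
                         {{ℕP.m*n≢0 d d}} {{ℕ.nonZero}} {{4d²≢0 d}} (rescale (dedekindℤ h d) (+ d) _ _ (ℤP.pos-* d d) 4d²≡))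
    where
    4d²≡ : + (2 ℕ.* d ℕ.* (2 ℕ.* d)) ≡ (+ 2 ℤ.* + d) ℤ.* (+ 2 ℤ.* + d)
    4d²≡ = trans (ℤP.pos-* (2 ℕ.* d) (2 ℕ.* d)) (cong₂ ℤ._*_ (ℤP.pos-* 2 d) (ℤP.pos-* 2 d))
    rescale : ∀ (s d d² D : ℤ) → d² ≡ d ℤ.* d → D ≡ (+ 2 ℤ.* d) ℤ.* (+ 2 ℤ.* d) →
              + 12 ℤ.* s ℤ.* d² ≡ (+ 3 ℤ.* s) ℤ.* (+ 1 ℤ.* D)
    rescale s d _ _ refl refl = solve (s ∷ d ∷ [])

  reciprocity-/ : ∀ (s₁ s₂ s₃ : ℤ) a b t .{{_ : NonZero a}} .{{_ : NonZero b}} .{{_ : NonZero t}} →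
    + 3 ℤ.* (+ a ℤ.* + a) ℤ.* (+ t ℤ.* + t) ℤ.* s₁ ℤ.+ + 3 ℤ.* (+ b ℤ.* + b) ℤ.* (+ t ℤ.* + t) ℤ.* s₂
      ≡ + a ℤ.* + b ℤ.* + t ℤ.* (+ a ℤ.* + a ℤ.+ + b ℤ.* + b ℤ.+ + t ℤ.* + t ℤ.- + 3 ℤ.* (+ a ℤ.* + b ℤ.* + t))
        ℤ.+ + 3 ℤ.* (+ a ℤ.* + a) ℤ.* (+ b ℤ.* + b) ℤ.* s₃ →
    ((+ 3 ℤ.* s₁) / (b ℕ.* b)) {{ℕP.m*n≢0 b b}} + ((+ 3 ℤ.* s₂) / (a ℕ.* a)) {{ℕP.m*n≢0 a a}}
      ≡ ((+ (a ℕ.* a ℕ.+ b ℕ.* b ℕ.+ t ℕ.* t) / (t ℕ.* a ℕ.* b)) {{tab≢0}} - + 3 / 1)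
        + ((+ 3 ℤ.* s₃) / (t ℕ.* t)) {{ℕP.m*n≢0 t t}}
  reciprocity-/ s₁ s₂ s₃ a b t relation = begin
    X₁ / (b ℕ.* b) + X₂ / (a ℕ.* a)          ≡⟨ /+/≡/ X₁ X₂ Z₁ (b ℕ.* b) (a ℕ.* a) (T ℕ.* T) left-cross ⟩
    Z₁ / (T ℕ.* T)                           ≡⟨ cong (_/ (T ℕ.* T)) relation ⟩
    Z₂ / (T ℕ.* T)                           ≡⟨ sym (/+/≡/ (N ℤ.- + 3 ℤ.* + T) X₃ Z₂ T (t ℕ.* t) (T ℕ.* T) right-cross) ⟩
    (N ℤ.- + 3 ℤ.* + T) / T + X₃ / (t ℕ.* t) ≡⟨ cong (_+ X₃ / (t ℕ.* t)) (sym (/+/≡/ N (ℤ.- + 3) (N ℤ.- + 3 ℤ.* + T) T 1 T minus-3)) ⟩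
    (N / T + (ℤ.- + 3) / 1) + X₃ / (t ℕ.* t) ≡⟨ cong (λ z → (N / T + z) + X₃ / (t ℕ.* t)) (sym (-‿/ (+ 3) 1)) ⟩
    (N / T - + 3 / 1) + X₃ / (t ℕ.* t)       ∎
    where
    T : ℕ
    T = t ℕ.* a ℕ.* b
    instance
      aa≢0 : NonZero (a ℕ.* a)
      aa≢0 = ℕP.m*n≢0 a a
      bb≢0 : NonZero (b ℕ.* b)
      bb≢0 = ℕP.m*n≢0 b b
      tt≢0 : NonZero (t ℕ.* t)
      tt≢0 = ℕP.m*n≢0 t t
      T≢0 : NonZero T
      T≢0 = tab≢0
      TT≢0 : NonZero (T ℕ.* T)
      TT≢0 = ℕP.m*n≢0 T T
    N X₁ X₂ X₃ Z₁ Z₂ : ℤ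
    N = + (a ℕ.* a ℕ.+ b ℕ.* b ℕ.+ t ℕ.* t)
    X₁ = + 3 ℤ.* s₁
    X₂ = + 3 ℤ.* s₂
    X₃ = + 3 ℤ.* s₃
    Z₁ = + 3 ℤ.* (+ a ℤ.* + a) ℤ.* (+ t ℤ.* + t) ℤ.* s₁ ℤ.+ + 3 ℤ.* (+ b ℤ.* + b) ℤ.* (+ t ℤ.* + t) ℤ.* s₂
    Z₂ = + a ℤ.* + b ℤ.* + t ℤ.* (+ a ℤ.* + a ℤ.+ + b ℤ.* + b ℤ.+ + t ℤ.* + t ℤ.- + 3 ℤ.* (+ a ℤ.* + b ℤ.* + t))
         ℤ.+ + 3 ℤ.* (+ a ℤ.* + a) ℤ.* (+ b ℤ.* + b) ℤ.* s₃
    ⟦T⟧ : + T ≡ + t ℤ.* + a ℤ.* + b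
    ⟦T⟧ = trans (ℤP.pos-* (t ℕ.* a) b) (cong (ℤ._* + b) (ℤP.pos-* t a))
    ⟦TT⟧ : + (T ℕ.* T) ≡ (+ t ℤ.* + a ℤ.* + b) ℤ.* (+ t ℤ.* + a ℤ.* + b)
    ⟦TT⟧ = trans (ℤP.pos-* T T) (cong₂ ℤ._*_ ⟦T⟧ ⟦T⟧)
    ⟦N⟧ : N ≡ + a ℤ.* + a ℤ.+ + b ℤ.* + b ℤ.+ + t ℤ.* + t
    ⟦N⟧ = trans (ℤP.pos-+ (a ℕ.* a ℕ.+ b ℕ.* b) (t ℕ.* t))
                (cong₂ ℤ._+_ (trans (ℤP.pos-+ (a ℕ.* a) (b ℕ.* b)) (cong₂ ℤ._+_ (ℤP.pos-* a a) (ℤP.pos-* b b))) (ℤP.pos-* t t))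
    left-cross-form : ∀ (a b t s₁ s₂ : ℤ) {A B TT} → A ≡ a ℤ.* a → B ≡ b ℤ.* b → TT ≡ (t ℤ.* a ℤ.* b) ℤ.* (t ℤ.* a ℤ.* b) →
                ((+ 3 ℤ.* s₁) ℤ.* A ℤ.+ (+ 3 ℤ.* s₂) ℤ.* B) ℤ.* TT
                ≡ (+ 3 ℤ.* (a ℤ.* a) ℤ.* (t ℤ.* t) ℤ.* s₁ ℤ.+ + 3 ℤ.* (b ℤ.* b) ℤ.* (t ℤ.* t) ℤ.* s₂) ℤ.* (B ℤ.* A)
    left-cross-form a b t s₁ s₂ refl refl refl = solve (a ∷ b ∷ t ∷ s₁ ∷ s₂ ∷ [])
    left-cross : (X₁ ℤ.* + (a ℕ.* a) ℤ.+ X₂ ℤ.* + (b ℕ.* b)) ℤ.* + (T ℕ.* T) ≡ Z₁ ℤ.* (+ (b ℕ.* b) ℤ.* + (a ℕ.* a))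
    left-cross = left-cross-form (+ a) (+ b) (+ t) s₁ s₂ (ℤP.pos-* a a) (ℤP.pos-* b b) ⟦TT⟧
    right-cross-form : ∀ (a b t s₃ : ℤ) {N T C TT} → N ≡ a ℤ.* a ℤ.+ b ℤ.* b ℤ.+ t ℤ.* t → T ≡ t ℤ.* a ℤ.* b → C ≡ t ℤ.* t →
                 TT ≡ (t ℤ.* a ℤ.* b) ℤ.* (t ℤ.* a ℤ.* b) →
                 ((N ℤ.- + 3 ℤ.* T) ℤ.* C ℤ.+ (+ 3 ℤ.* s₃) ℤ.* T) ℤ.* TT
                 ≡ (a ℤ.* b ℤ.* t ℤ.* (a ℤ.* a ℤ.+ b ℤ.* b ℤ.+ t ℤ.* t ℤ.- + 3 ℤ.* (a ℤ.* b ℤ.* t))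
                    ℤ.+ + 3 ℤ.* (a ℤ.* a) ℤ.* (b ℤ.* b) ℤ.* s₃) ℤ.* (T ℤ.* C)
    right-cross-form a b t s₃ refl refl refl refl = solve (a ∷ b ∷ t ∷ s₃ ∷ [])
    right-cross : ((N ℤ.- + 3 ℤ.* + T) ℤ.* + (t ℕ.* t) ℤ.+ X₃ ℤ.* + T) ℤ.* + (T ℕ.* T) ≡ Z₂ ℤ.* (+ T ℤ.* + (t ℕ.* t))
    right-cross = right-cross-form (+ a) (+ b) (+ t) s₃ ⟦N⟧ ⟦T⟧ (ℤP.pos-* t t) ⟦TT⟧
    minus-3-form : ∀ (N T : ℤ) → (N ℤ.* + 1 ℤ.+ ℤ.- + 3 ℤ.* T) ℤ.* T ≡ (N ℤ.- + 3 ℤ.* T) ℤ.* (T ℤ.* + 1)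
    minus-3-form = solve-∀
    minus-3 : (N ℤ.* + 1 ℤ.+ ℤ.- + 3 ℤ.* + T) ℤ.* + T ≡ (N ℤ.- + 3 ℤ.* + T) ℤ.* (+ T ℤ.* + 1)
    minus-3 = minus-3-form N (+ T)


open import Defs
open import Data.Nat as ℕ using (ℕ; NonZero)
open import Data.Nat.Properties using (m*n≢0)
open import Data.Nat.Coprimality using (Coprime)
open import Data.Nat.Divisibility using (_∣_)
open import Data.Nat.GCD using (gcd)
open import Data.Integer as ℤ using (ℤ; +_)
open import Data.Integer.Divisibility as ℤD using ()
open import Data.Rational using (ℚ; _/_; _+_; _-_)
open import Relation.Binary.PropositionalEquality using (_≡_; cong; cong₂; sym; module ≡-Reasoning)
open ≡-Reasoning
open Reciprocity using (dedekindℤ; reciprocityℤ; ∣⇒inverseMod)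
open Sawtooth using (S-/; reciprocity-/)

theorem1 : (a b t : ℕ) → {{na : NonZero a}} → {{nb : NonZero b}} →
    Coprime a b →
    t ∣ (a ℕ.* a ℕ.+ 1) →
    {{nt : NonZero t}} →
    gcd b t ≡ 1 →
    (a* b* : ℤ) →
    (+ b) ℤD.∣ ((+ a ℤ.* a*) ℤ.- + 1) →
    (+ a) ℤD.∣ ((+ b ℤ.* b*) ℤ.- + 1) →
    S (+ t ℤ.* a*) b + S (+ t ℤ.* b*) a
      ≡ ((+ (a ℕ.* a ℕ.+ b ℕ.* b ℕ.+ t ℕ.* t) / (t ℕ.* a ℕ.* b))
           {{m*n≢0 (t ℕ.* a) b {{m*n≢0 t a}}}}
         - (+ 3 / 1))
        + S (+ (a ℕ.* b)) t
theorem1 a b t _ t∣a²+1 gcd[b,t]≡1 a* b* b∣aa*-1 a∣bb*-1 = begin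
  S (+ t ℤ.* a*) b + S (+ t ℤ.* b*) a
    ≡⟨ cong₂ _+_ (S-/ (+ t ℤ.* a*) b) (S-/ (+ t ℤ.* b*) a) ⟩
  ((+ 3 ℤ.* s₁) / (b ℕ.* b)) {{m*n≢0 b b}} + ((+ 3 ℤ.* s₂) / (a ℕ.* a)) {{m*n≢0 a a}}
    ≡⟨ reciprocity-/ s₁ s₂ s₃ a b t
         (reciprocityℤ a b t (∣⇒inverseMod (+ a) a* b∣aa*-1) (∣⇒inverseMod (+ b) b* a∣bb*-1) t∣a²+1 gcd[b,t]≡1) ⟩
  (N/tab - + 3 / 1) + ((+ 3 ℤ.* s₃) / (t ℕ.* t)) {{m*n≢0 t t}}
    ≡⟨ cong (_+_ (N/tab - + 3 / 1)) (sym (S-/ (+ (a ℕ.* b)) t)) ⟩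
  (N/tab - + 3 / 1) + S (+ (a ℕ.* b)) t
    ∎
  where
  s₁ s₂ s₃ : ℤ
  s₁ = dedekindℤ (+ t ℤ.* a*) b
  s₂ = dedekindℤ (+ t ℤ.* b*) a
  s₃ = dedekindℤ (+ (a ℕ.* b)) t
  N/tab : ℚ
  N/tab = (+ (a ℕ.* a ℕ.+ b ℕ.* b ℕ.+ t ℕ.* t) / (t ℕ.* a ℕ.* b)) {{m*n≢0 (t ℕ.* a) b {{m*n≢0 t a}}}}
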